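{- Let $k\geq 3$ and $s\in\{1,2,\dots,k-1\}$, let $K=N(k)$, $K'=N(s+2)$, and let $(K,\circ)$ and $(K',\star)$ be any idempotent quasigroups of orders $k$ and $s+2$ respectively. Then the array $U_{k,s}$ of order $k+s+2$ defined below is a non-separable $k$-latin square: $U_{k,s}(i,i)=\{i,(k+1)^{k-1}\}$ for $i\in K$; $U_{k,s}(i\odot 1,i)=\{k+1,((i\odot 1)\circ i)^{k-s-1},k+3,k+4,\dots,k+s+2\}$ for $i\in K$; $U_{k,s}(i,j)=\{k+2,(i\circ j)^{k-s-1},k+3,k+4,\dots,k+s+2\}$ for $i,j\in K$ with $i\neq j$ and $i\neq j\odot 1$; $U_{k,s}(i,k+1)=U_{k,s}(k+1,i)=\{i^{k-1},k+2\}$ for $i\in K$; $U_{k,s}(i,k+x)=U_{k,s}(k+x,i)=\{k+x\}\cup(K\setminus\{i\})$ for $i\in K$, $2\leq x\leq s+2$; $U_{k,s}(k+x,k+y)=K$ for $x,y\in K'$ with $x\star y=1$; $U_{k,s}(k+x,k+y)=(k+1)^k$ for $x,y\in K'$ with $x\star y=2$; $U_{k,s}(k+x,k+x)=(k+2)^k$ for $x\in K'$ with $x\geq 3$; $U_{k,s}(k+x,k+y)=(k+z)^k$ for $x,y,z\in K'$ with $x\star y=z\geq 3$ and $x\neq y$.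
   Context: For a positive integer $a$, $N(a)=\{1,\dots,a\}$, and for an integer $x$, $(x \bmod a)$ denotes the unique element of $N(a)$ congruent to $x$ modulo $a$. For $a,b\in K=N(k)$, $a\odot b=(a+b \bmod k)$. In a multiset, $x^y$ means $y$ copies of $x$. An idempotent quasigroup is a quasigroup with $a\circ a=a$ for all $a$. A $k$-latin square of order $n$ is an $n\times n$ array $L$ whose cell $(i,j)$ contains a multiset $L(i,j)$ of exactly $k$ elements of $N(n)$, such that each symbol occurs exactly $k$ times (counting multiplicity) in each row and in each column. The join of a $k_1$-latin square and a $k_2$-latin square of the same order is the $(k_1+k_2)$-latin square with cellwise multiset unions. A $k$-latin square is separable if for some positive $k_1,k_2<k$ with $k_1+k_2=k$ it is the join of a $k_1$-latin square and a $k_2$-latin square; otherwise non-separable. -}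

module Defs where

open import Data.Nat using (ℕ; zero; suc; _+_; _∸_; _≤_; _<_; _≡ᵇ_; _≤ᵇ_; _%_)
open import Data.Bool using (Bool; true; false; if_then_else_; not; _∧_)
open import Data.List using (List; []; _∷_; _++_; replicate; map; upTo; filterᵇ; length)
open import Data.List.Relation.Unary.All using (All)
open import Data.List.Relation.Binary.Permutation.Propositional using (_↭_)
open import Data.Product using (_×_; Σ; ∃; ∃-syntax)
open import Relation.Binary.PropositionalEquality using (_≡_)
open import Relation.Nullary using (¬_)

_∈N_ : ℕ → ℕ → Set
x ∈N a = (1 ≤ x) × (x ≤ a)

-- (x mod a) ∈ N(a), the representative of x modulo a in {1,…,a} (for a ≥ 1)
modN : ℕ → ℕ → ℕ
modN zero    x = x            -- irrelevant case a = 0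
modN (suc a) x = suc ((x ∸ 1) % suc a)   -- valid for x ≥ 1

odot : ℕ → ℕ → ℕ → ℕ
odot k a b = modN k (a + b)

fromTo : ℕ → ℕ → List ℕ
fromTo a b = map (λ t → a + t) (upTo (suc b ∸ a))

mult : ℕ → List ℕ → ℕ
mult x []       = 0
mult x (y ∷ ys) = (if x ≡ᵇ y then 1 else 0) + mult x ys

sumTo : ℕ → (ℕ → ℕ) → ℕ
sumTo zero    f = 0
sumTo (suc n) f = sumTo n f + f (suc n)

-- an idempotent quasigroup on N(k), given by a binary operation on ℕ
-- (only its values on N(k) matter)
record IsIdempotentQuasigroup (k : ℕ) (op : ℕ → ℕ → ℕ) : Set where
  field
    closed     : ∀ a b → a ∈N k → b ∈N k → op a b ∈N k
    leftDiv    : ∀ a b → a ∈N k → b ∈N k → ∃[ x ] (x ∈N k × op a x ≡ b)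
    leftCancel : ∀ a x y → a ∈N k → x ∈N k → y ∈N k → op a x ≡ op a y → x ≡ y
    rightDiv   : ∀ a b → a ∈N k → b ∈N k → ∃[ y ] (y ∈N k × op y a ≡ b)
    rightCancel : ∀ a x y → a ∈N k → x ∈N k → y ∈N k → op x a ≡ op y a → x ≡ y
    idempotent : ∀ a → a ∈N k → op a a ≡ a

-- an array of order n: cell (i,j), for i,j ∈ N(n), holds a multiset (list) of symbols
Array : Set
Array = ℕ → ℕ → List ℕ

IsKLatin : ℕ → ℕ → Array → Set
IsKLatin k n L =
    (∀ i j → i ∈N n → j ∈N n → (length (L i j) ≡ k) × All (_∈N n) (L i j))
  × (∀ i x → i ∈N n → x ∈N n → sumTo n (λ j → mult x (L i j)) ≡ k)
  × (∀ j x → j ∈N n → x ∈N n → sumTo n (λ i → mult x (L i j)) ≡ k)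

IsJoin : ℕ → Array → Array → Array → Set
IsJoin n L L₁ L₂ = ∀ i j → i ∈N n → j ∈N n → L i j ↭ (L₁ i j ++ L₂ i j)

Separable : ℕ → ℕ → Array → Set
Separable k n L =
  ∃[ k₁ ] ∃[ k₂ ] ∃[ L₁ ] ∃[ L₂ ]
    ( (1 ≤ k₁) × (1 ≤ k₂) × (k₁ + k₂ ≡ k)
    × IsKLatin k₁ n L₁ × IsKLatin k₂ n L₂ × IsJoin n L L₁ L₂ )

NonSeparable : ℕ → ℕ → Array → Set
NonSeparable k n L = ¬ Separable k n L

Kminus : ℕ → ℕ → List ℕ
Kminus k i = filterᵇ (λ t → not (t ≡ᵇ i)) (fromTo 1 k)

-- the array U_{k,s} (order k+s+2); cells outside N(k+s+2)² are [] (irrelevant)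
U : (k s : ℕ) → (circ star : ℕ → ℕ → ℕ) → Array
U k s circ star i j =
  if inK i ∧ inK j then
    (if i ≡ᵇ j then i ∷ replicate (k ∸ 1) (k + 1)
     else if i ≡ᵇ odot k j 1
       then (k + 1) ∷ (replicate (k ∸ s ∸ 1) (circ i j) ++ fromTo (k + 3) (k + s + 2))
       else (k + 2) ∷ (replicate (k ∸ s ∸ 1) (circ i j) ++ fromTo (k + 3) (k + s + 2)))
  else if inK i ∧ inK' j then sideCell i j
  else if inK' i ∧ inK j then sideCell j i
  else if inK' i ∧ inK' j then corner (i ∸ k) (j ∸ k)
  else []
  where
  inK : ℕ → Bool
  inK t = (1 ≤ᵇ t) ∧ (t ≤ᵇ k)
  inK' : ℕ → Bool           -- t = k + x with x ∈ K' = N(s+2)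
  inK' t = (k + 1 ≤ᵇ t) ∧ (t ≤ᵇ k + s + 2)
  sideCell : ℕ → ℕ → List ℕ
  sideCell a t = if t ≡ᵇ k + 1 then replicate (k ∸ 1) a ++ (k + 2 ∷ [])
                 else t ∷ Kminus k a
  corner : ℕ → ℕ → List ℕ
  corner x y =
    if star x y ≡ᵇ 1 then fromTo 1 k
    else if star x y ≡ᵇ 2 then replicate k (k + 1)
    else if x ≡ᵇ y then replicate k (k + 2)
    else replicate k (k + star x y)

module Submission where

-- The columns of U are the rows of its
-- transpose, which is again of the form V (for the reversed quasigroups and
-- the adjacency j = i ⊙ 1), so U is k-latin (U-latin).  For
-- non-separability (module NonSeparability) we show that every k₁-latin
-- square contained cellwise in U has k ∣ k₁, by following the symbols i,
-- k+1 and k+2 through the few cells of U containing them; hence U is not a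
-- join of a k₁- and a k₂-latin square with k₁, k₂ ≥ 1.  The theorem
-- combines the two results.

open import Defs
open import Data.Nat
open import Data.Nat.Properties
open import Data.Nat.DivMod using (m<n⇒m%n≡m; n%n≡0)
open import Data.Nat.Tactic.RingSolver using (solve-∀)
open import Data.Nat.Divisibility using (_∣_; divides; ∣⇒≤)
open import Algebra.Properties.CommutativeSemigroup +-commutativeSemigroup using (xy∙z≈xz∙y; x∙yz≈y∙xz)
open import Data.Bool using (Bool; true; false; if_then_else_; not; _∧_; T)
open import Data.List using (List; []; _∷_; _++_; replicate; map; upTo; filterᵇ; length)
open import Data.List.Properties using (length-++; length-replicate; length-map; length-upTo; applyUpTo-∷ʳ)
open import Data.List.Relation.Unary.All using (All; []; _∷_)
import Data.List.Relation.Unary.All as All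
open import Data.List.Relation.Unary.All.Properties using (++⁺; replicate⁺; map⁺; applyUpTo⁺₁; filter⁺)
open import Data.List.Relation.Binary.Permutation.Propositional using (_↭_)
import Data.List.Relation.Binary.Permutation.Propositional as ↭
open import Data.Product using (_×_; _,_; proj₁; proj₂; Σ; ∃-syntax)
open import Data.Sum using (_⊎_; inj₁; inj₂)
open import Data.Empty using (⊥-elim)
open import Function using (_∘_; id; flip)
open import Relation.Binary.PropositionalEquality
open import Relation.Nullary using (yes; no)
open import Relation.Nullary.Decidable using (T?)

≡ᵇ-refl : ∀ x → (x ≡ᵇ x) ≡ true
≡ᵇ-refl zero    = refl
≡ᵇ-refl (suc x) = ≡ᵇ-refl x

≢⇒≡ᵇ-false : ∀ {x y} → x ≢ y → (x ≡ᵇ y) ≡ false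
≢⇒≡ᵇ-false {x} {y} x≢y with x ≡ᵇ y in eq
... | false = refl
... | true  = ⊥-elim (x≢y (≡ᵇ⇒≡ x y (subst T (sym eq) _)))

≡ᵇ-sym : ∀ x y → (x ≡ᵇ y) ≡ (y ≡ᵇ x)
≡ᵇ-sym zero    zero    = refl
≡ᵇ-sym zero    (suc y) = refl
≡ᵇ-sym (suc x) zero    = refl
≡ᵇ-sym (suc x) (suc y) = ≡ᵇ-sym x y

≡ᵇ-+ : ∀ a t y → (a + t ≡ᵇ a + y) ≡ (t ≡ᵇ y)
≡ᵇ-+ zero    t y = refl
≡ᵇ-+ (suc a) t y = ≡ᵇ-+ a t y

≤⇒≤ᵇ-true : ∀ {x y} → x ≤ y → (x ≤ᵇ y) ≡ true
≤⇒≤ᵇ-true {x} {y} x≤y with x ≤ᵇ y | ≤⇒≤ᵇ x≤y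
... | true | _ = refl

>⇒≤ᵇ-false : ∀ {x y} → y < x → (x ≤ᵇ y) ≡ false
>⇒≤ᵇ-false {x} {y} y<x with x ≤ᵇ y in eq
... | false = refl
... | true  = ⊥-elim (<⇒≱ y<x (≤ᵇ⇒≤ x y (subst T (sym eq) _)))

-- Besides the usual congruence/splitting
-- rules, every count in the proof is of the form "f vanishes (or is 1)
-- outside one or two points", which is handled by changing f at one point.

sum-cong : ∀ n {f g : ℕ → ℕ} → (∀ j → j ∈N n → f j ≡ g j) → sumTo n f ≡ sumTo n g
sum-cong zero    f≗g = refl
sum-cong (suc n) f≗g =
  cong₂ _+_ (sum-cong n (λ j (1≤j , j≤n) → f≗g j (1≤j , m≤n⇒m≤1+n j≤n))) (f≗g (suc n) (s≤s z≤n , ≤-refl))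

sum-const : ∀ n c → sumTo n (λ _ → c) ≡ n * c
sum-const zero    c = refl
sum-const (suc n) c = trans (cong (_+ c) (sum-const n c)) (+-comm (n * c) c)

sum-split : ∀ m n (f : ℕ → ℕ) → sumTo (m + n) f ≡ sumTo m f + sumTo n (λ j → f (m + j))
sum-split m zero    f rewrite +-identityʳ m = sym (+-identityʳ _)
sum-split m (suc n) f rewrite +-suc m n | sum-split m n f = +-assoc (sumTo m f) _ _

sum-update : ∀ n {f g : ℕ → ℕ} j₀ → j₀ ∈N n → (∀ j → j ∈N n → j ≢ j₀ → f j ≡ g j) →
             sumTo n f + g j₀ ≡ sumTo n g + f j₀
sum-update zero    j₀ (1≤j₀ , j₀≤0) _ = ⊥-elim (<⇒≱ 1≤j₀ j₀≤0)
sum-update (suc n) {f} {g} j₀ (1≤j₀ , j₀≤n+1) f≗g with m≤n⇒m<n∨m≡n j₀≤n+1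
... | inj₁ (s≤s j₀≤n) rewrite f≗g (suc n) (s≤s z≤n , ≤-refl) (>⇒≢ (s≤s j₀≤n)) = begin
  sumTo n f + g (suc n) + g j₀    ≡⟨ xy∙z≈xz∙y (sumTo n f) _ _ ⟩
  sumTo n f + g j₀ + g (suc n)    ≡⟨ cong (_+ g (suc n)) (sum-update n j₀ (1≤j₀ , j₀≤n) f≗g-below) ⟩
  sumTo n g + f j₀ + g (suc n)    ≡⟨ xy∙z≈xz∙y (sumTo n g) _ _ ⟩
  sumTo n g + g (suc n) + f j₀    ∎
  where
  open ≡-Reasoning
  f≗g-below : ∀ j → j ∈N n → j ≢ j₀ → f j ≡ g j
  f≗g-below j (1≤j , j≤n) = f≗g j (1≤j , m≤n⇒m≤1+n j≤n)
... | inj₂ refl rewrite sum-cong n {f} {g} (λ j (1≤j , j≤n) → f≗g j (1≤j , m≤n⇒m≤1+n j≤n) (<⇒≢ (s≤s j≤n))) =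
  xy∙z≈xz∙y (sumTo n g) (f (suc n)) (g (suc n))

sum-zero : ∀ n {f : ℕ → ℕ} → (∀ j → j ∈N n → f j ≡ 0) → sumTo n f ≡ 0
sum-zero n f≗0 = trans (sum-cong n f≗0) (trans (sum-const n 0) (*-zeroʳ n))

sum-all-ones : ∀ n {f : ℕ → ℕ} → (∀ j → j ∈N n → f j ≡ 1) → sumTo n f ≡ n
sum-all-ones n f≗1 = trans (sum-cong n f≗1) (trans (sum-const n 1) (*-identityʳ n))

sum-one : ∀ n {f : ℕ → ℕ} j₀ → j₀ ∈N n → (∀ j → j ∈N n → j ≢ j₀ → f j ≡ 0) → sumTo n f ≡ f j₀
sum-one n {f} j₀ j₀∈ f≗0 = begin
  sumTo n f                        ≡⟨ sym (+-identityʳ _) ⟩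
  sumTo n f + 0                    ≡⟨ sum-update n j₀ j₀∈ f≗0 ⟩
  sumTo n (λ _ → 0) + f j₀         ≡⟨ cong (_+ f j₀) (sum-zero n (λ _ _ → refl)) ⟩
  f j₀                             ∎
  where open ≡-Reasoning

overwrite : (ℕ → ℕ) → ℕ → ℕ → ℕ → ℕ
overwrite f j₁ v j = if j ≡ᵇ j₁ then v else f j

overwrite-at : ∀ f j₁ v → overwrite f j₁ v j₁ ≡ v
overwrite-at f j₁ v rewrite ≡ᵇ-refl j₁ = refl

overwrite-off : ∀ f {j₁} v {j} → j ≢ j₁ → overwrite f j₁ v j ≡ f j
overwrite-off f v j≢j₁ rewrite ≢⇒≡ᵇ-false j≢j₁ = refl

sum-two : ∀ n {f : ℕ → ℕ} j₀ j₁ → j₀ ∈N n → j₁ ∈N n → j₀ ≢ j₁ →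
          (∀ j → j ∈N n → j ≢ j₀ → j ≢ j₁ → f j ≡ 0) → sumTo n f ≡ f j₀ + f j₁
sum-two n {f} j₀ j₁ j₀∈ j₁∈ j₀≢j₁ f≗0 = begin
  sumTo n f                        ≡⟨ sym (+-identityʳ _) ⟩
  sumTo n f + 0                    ≡⟨ cong (sumTo n f +_) (sym (overwrite-at f j₁ 0)) ⟩
  sumTo n f + g j₁                 ≡⟨ sum-update n j₁ j₁∈ (λ j _ j≢j₁ → sym (overwrite-off f 0 j≢j₁)) ⟩
  sumTo n g + f j₁                 ≡⟨ cong (_+ f j₁) (sum-one n j₀ j₀∈ g≗0) ⟩
  g j₀ + f j₁                      ≡⟨ cong (_+ f j₁) (overwrite-off f 0 j₀≢j₁) ⟩
  f j₀ + f j₁                      ∎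
  where
  open ≡-Reasoning
  g : ℕ → ℕ
  g = overwrite f j₁ 0
  g≗0 : ∀ j → j ∈N n → j ≢ j₀ → g j ≡ 0
  g≗0 j j∈ j≢j₀ with j ≟ j₁
  ... | yes refl = overwrite-at f j 0
  ... | no j≢j₁  = trans (overwrite-off f 0 j≢j₁) (f≗0 j j∈ j≢j₀ j≢j₁)

sum-ones-but-one : ∀ n {f : ℕ → ℕ} j₀ → j₀ ∈N n → f j₀ ≡ 0 →
                   (∀ j → j ∈N n → j ≢ j₀ → f j ≡ 1) → sumTo n f + 1 ≡ n
sum-ones-but-one n {f} j₀ j₀∈ fj₀≡0 f≗1 = begin
  sumTo n f + 1                    ≡⟨ sum-update n j₀ j₀∈ f≗1 ⟩
  sumTo n (λ _ → 1) + f j₀         ≡⟨ cong₂ _+_ (sum-all-ones n (λ _ _ → refl)) fj₀≡0 ⟩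
  n + 0                            ≡⟨ +-identityʳ n ⟩
  n                                ∎
  where open ≡-Reasoning

sum-ones-but-two : ∀ n {f : ℕ → ℕ} j₀ j₁ → j₀ ∈N n → j₁ ∈N n → j₀ ≢ j₁ → f j₀ ≡ 0 → f j₁ ≡ 0 →
                   (∀ j → j ∈N n → j ≢ j₀ → j ≢ j₁ → f j ≡ 1) → sumTo n f + 2 ≡ n
sum-ones-but-two n {f} j₀ j₁ j₀∈ j₁∈ j₀≢j₁ fj₀≡0 fj₁≡0 f≗1 = begin
  sumTo n f + 2                    ≡⟨ sym (+-assoc (sumTo n f) 1 1) ⟩
  sumTo n f + 1 + 1                ≡⟨ cong (λ t → sumTo n f + t + 1) (sym (overwrite-at f j₁ 1)) ⟩
  sumTo n f + g j₁ + 1             ≡⟨ cong (_+ 1) (sum-update n j₁ j₁∈ (λ j _ j≢j₁ → sym (overwrite-off f 1 j≢j₁))) ⟩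
  sumTo n g + f j₁ + 1             ≡⟨ cong (λ t → sumTo n g + t + 1) fj₁≡0 ⟩
  sumTo n g + 0 + 1                ≡⟨ cong (_+ 1) (+-identityʳ _) ⟩
  sumTo n g + 1                    ≡⟨ sum-ones-but-one n j₀ j₀∈ (trans (overwrite-off f 1 j₀≢j₁) fj₀≡0) g≗1 ⟩
  n                                ∎
  where
  open ≡-Reasoning
  g : ℕ → ℕ
  g = overwrite f j₁ 1
  g≗1 : ∀ j → j ∈N n → j ≢ j₀ → g j ≡ 1
  g≗1 j j∈ j≢j₀ with j ≟ j₁
  ... | yes refl = overwrite-at f j 1
  ... | no j≢j₁  = trans (overwrite-off f 1 j≢j₁) (f≗1 j j∈ j≢j₀ j≢j₁)

mult-here : ∀ x (l : List ℕ) → mult x (x ∷ l) ≡ suc (mult x l)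
mult-here x l rewrite ≡ᵇ-refl x = refl

mult-there : ∀ {x y} (l : List ℕ) → x ≢ y → mult x (y ∷ l) ≡ mult x l
mult-there l x≢y rewrite ≢⇒≡ᵇ-false x≢y = refl

mult-++ : ∀ x (l m : List ℕ) → mult x (l ++ m) ≡ mult x l + mult x m
mult-++ x []      m = refl
mult-++ x (y ∷ l) m rewrite mult-++ x l m = sym (+-assoc (if x ≡ᵇ y then 1 else 0) _ _)

mult-replicate-self : ∀ n a → mult a (replicate n a) ≡ n
mult-replicate-self zero    a = refl
mult-replicate-self (suc n) a = trans (mult-here a (replicate n a)) (cong suc (mult-replicate-self n a))

mult-replicate-other : ∀ {x a} n → x ≢ a → mult x (replicate n a) ≡ 0
mult-replicate-other zero    x≢a = refl
mult-replicate-other (suc n) x≢a = trans (mult-there (replicate n _) x≢a) (mult-replicate-other n x≢a)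

mult-↭ : ∀ x {l m : List ℕ} → l ↭ m → mult x l ≡ mult x m
mult-↭ x ↭.refl         = refl
mult-↭ x (↭.prep y l↭m) = cong ((if x ≡ᵇ y then 1 else 0) +_) (mult-↭ x l↭m)
mult-↭ x (↭.swap y z l↭m) rewrite mult-↭ x l↭m = x∙yz≈y∙xz (if x ≡ᵇ y then 1 else 0) (if x ≡ᵇ z then 1 else 0) _
mult-↭ x (↭.trans l↭m m↭n) = trans (mult-↭ x l↭m) (mult-↭ x m↭n)

length-two-symbols : ∀ {a b} (l : List ℕ) → a ≢ b → (∀ y → y ≢ a → y ≢ b → mult y l ≡ 0) →
                     length l ≡ mult a l + mult b l
length-two-symbols []            a≢b only = refl
length-two-symbols {a} {b} (y ∷ l) a≢b only with y ≟ a | y ≟ b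
... | yes refl | _ rewrite mult-here y l | mult-there {b} l (≢-sym a≢b) =
  cong suc (length-two-symbols l a≢b (λ z z≢a z≢b → trans (sym (mult-there l z≢a)) (only z z≢a z≢b)))
... | no _ | yes refl rewrite mult-here y l | mult-there {a} l a≢b =
  trans (cong suc (length-two-symbols l a≢b (λ z z≢a z≢b → trans (sym (mult-there l z≢b)) (only z z≢a z≢b))))
           (sym (+-suc (mult a l) (mult y l)))
... | no y≢a | no y≢b with only y y≢a y≢b
... | y∉l rewrite mult-here y l = ⊥-elim (1+n≢0 y∉l)

mult-upTo-suc : ∀ t m → mult t (upTo (suc m)) ≡ mult t (upTo m) + mult t (m ∷ [])
mult-upTo-suc t m = trans (cong (mult t) (sym (applyUpTo-∷ʳ id m))) (mult-++ t (upTo m) (m ∷ []))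

mult-upTo-out : ∀ {t} m → m ≤ t → mult t (upTo m) ≡ 0
mult-upTo-out zero    m≤t = refl
mult-upTo-out {t} (suc m) m<t rewrite mult-upTo-suc t m | mult-upTo-out m (<⇒≤ m<t)
                                    | mult-there {t} [] (>⇒≢ m<t) = refl

mult-upTo-in : ∀ {t m} → t < m → mult t (upTo m) ≡ 1
mult-upTo-in {t} {suc m} (s≤s t≤m) with m≤n⇒m<n∨m≡n t≤m
... | inj₁ t<m rewrite mult-upTo-suc t m | mult-upTo-in t<m | mult-there {t} [] (<⇒≢ t<m) = refl
... | inj₂ refl rewrite mult-upTo-suc t t | mult-upTo-out t ≤-refl | mult-here t [] = refl

mult-shift : ∀ a t (l : List ℕ) → mult (a + t) (map (a +_) l) ≡ mult t l
mult-shift a t []      = refl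
mult-shift a t (y ∷ l) rewrite ≡ᵇ-+ a t y = cong (_ +_) (mult-shift a t l)

mult-shift-below : ∀ {a x} (l : List ℕ) → x < a → mult x (map (a +_) l) ≡ 0
mult-shift-below []      x<a = refl
mult-shift-below {a} (y ∷ l) x<a =
  trans (mult-there (map (a +_) l) (<⇒≢ (≤-trans x<a (m≤m+n a y)))) (mult-shift-below l x<a)

mult-fromTo-in : ∀ {a b x} → a ≤ x → x ≤ b → mult x (fromTo a b) ≡ 1
mult-fromTo-in {a} {b} {x} a≤x x≤b = begin
  mult x (fromTo a b)                  ≡⟨ cong (λ y → mult y (fromTo a b)) (sym (m+[n∸m]≡n a≤x)) ⟩
  mult (a + (x ∸ a)) (fromTo a b)      ≡⟨ mult-shift a (x ∸ a) (upTo (suc b ∸ a)) ⟩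
  mult (x ∸ a) (upTo (suc b ∸ a))      ≡⟨ mult-upTo-in (∸-monoˡ-< (s≤s x≤b) a≤x) ⟩
  1                                    ∎
  where open ≡-Reasoning

mult-fromTo-below : ∀ {a b x} → x < a → mult x (fromTo a b) ≡ 0
mult-fromTo-below {a} {b} x<a = mult-shift-below (upTo (suc b ∸ a)) x<a

mult-fromTo-above : ∀ {a b x} → b < x → mult x (fromTo a b) ≡ 0
mult-fromTo-above {a} {b} {x} b<x with x <? a
... | yes x<a = mult-fromTo-below x<a
... | no x≮a = begin
  mult x (fromTo a b)                  ≡⟨ cong (λ y → mult y (fromTo a b)) (sym (m+[n∸m]≡n (≮⇒≥ x≮a))) ⟩
  mult (a + (x ∸ a)) (fromTo a b)      ≡⟨ mult-shift a (x ∸ a) (upTo (suc b ∸ a)) ⟩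
  mult (x ∸ a) (upTo (suc b ∸ a))      ≡⟨ mult-upTo-out _ (∸-monoˡ-≤ a b<x) ⟩
  0                                    ∎
  where open ≡-Reasoning

length-fromTo : ∀ a b → length (fromTo a b) ≡ suc b ∸ a
length-fromTo a b = trans (length-map (a +_) (upTo (suc b ∸ a))) (length-upTo (suc b ∸ a))

All-fromTo : ∀ a b → All (λ t → a ≤ t × t ≤ b) (fromTo a b)
All-fromTo a b = map⁺ (applyUpTo⁺₁ id (suc b ∸ a) bounds)
  where
  bounds : ∀ {t} → t < suc b ∸ a → a ≤ a + t × a + t ≤ b
  bounds {t} t<m = m≤m+n a t , ≤-pred (begin-strict
    a + t               <⟨ +-monoʳ-< a t<m ⟩
    a + (suc b ∸ a)     ≡⟨ m+[n∸m]≡n {a} (<⇒≤ (m∸n≢0⇒n<m (>⇒≢ (≤-trans (s≤s z≤n) t<m)))) ⟩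
    suc b               ∎)
    where open ≤-Reasoning

mult-filter-kept : ∀ (p : ℕ → Bool) {x} (l : List ℕ) → p x ≡ true → mult x (filterᵇ p l) ≡ mult x l
mult-filter-kept p []      px = refl
mult-filter-kept p {x} (y ∷ l) px with p y in py | x ≟ y
... | true  | _        = cong (_ +_) (mult-filter-kept p l px)
... | false | no x≢y   = trans (mult-filter-kept p l px) (sym (mult-there l x≢y))
... | false | yes refl with () ← trans (sym px) py

mult-filter-dropped : ∀ (p : ℕ → Bool) {x} (l : List ℕ) → p x ≡ false → mult x (filterᵇ p l) ≡ 0
mult-filter-dropped p []      px = refl
mult-filter-dropped p {x} (y ∷ l) px with p y in py | x ≟ y
... | false | _        = mult-filter-dropped p l px
... | true  | no x≢y   = trans (mult-there (filterᵇ p l) x≢y) (mult-filter-dropped p l px)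
... | true  | yes refl with () ← trans (sym px) py

length-remove : ∀ i (l : List ℕ) → length l ≡ length (filterᵇ (λ t → not (t ≡ᵇ i)) l) + mult i l
length-remove i []      = refl
length-remove i (y ∷ l) with y ≟ i
... | yes refl rewrite ≡ᵇ-refl y = trans (cong suc (length-remove y l)) (sym (+-suc _ _))
... | no y≢i rewrite ≢⇒≡ᵇ-false y≢i | ≡ᵇ-sym i y | ≢⇒≡ᵇ-false y≢i = cong suc (length-remove i l)

mult-Kminus-self : ∀ k i → mult i (Kminus k i) ≡ 0
mult-Kminus-self k i = mult-filter-dropped _ (fromTo 1 k) (cong not (≡ᵇ-refl i))

mult-Kminus-other : ∀ {k i x} → x ≢ i → x ∈N k → mult x (Kminus k i) ≡ 1
mult-Kminus-other {k} x≢i (1≤x , x≤k) =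
  trans (mult-filter-kept _ (fromTo 1 k) (cong not (≢⇒≡ᵇ-false x≢i))) (mult-fromTo-in 1≤x x≤k)

mult-Kminus-above : ∀ {k i x} → k < x → mult x (Kminus k i) ≡ 0
mult-Kminus-above {k} {i} {x} k<x with x ≟ i
... | yes refl = mult-Kminus-self k x
... | no x≢i   = trans (mult-filter-kept _ (fromTo 1 k) (cong not (≢⇒≡ᵇ-false x≢i))) (mult-fromTo-above {1} k<x)

length-Kminus : ∀ {k i} → i ∈N k → length (Kminus k i) ≡ k ∸ 1
length-Kminus {k} {i} (1≤i , i≤k) = begin
  length (Kminus k i)                           ≡⟨ sym (m+n∸n≡m (length (Kminus k i)) 1) ⟩
  length (Kminus k i) + 1 ∸ 1                   ≡⟨ cong (λ t → length (Kminus k i) + t ∸ 1) (sym (mult-fromTo-in 1≤i i≤k)) ⟩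
  length (Kminus k i) + mult i (fromTo 1 k) ∸ 1 ≡⟨ cong (_∸ 1) (sym (length-remove i (fromTo 1 k))) ⟩
  length (fromTo 1 k) ∸ 1                       ≡⟨ cong (_∸ 1) (length-fromTo 1 k) ⟩
  k ∸ 1                                         ∎
  where open ≡-Reasoning

All-Kminus : ∀ {P : ℕ → Set} k i → All P (fromTo 1 k) → All P (Kminus k i)
All-Kminus k i = filter⁺ (T? ∘ (λ t → not (t ≡ᵇ i)))

-- Inside the K×K block a cell
-- off the diagonal is of one of two kinds, according to a Boolean
-- "adjacency" relation; for U it is i = j ⊙ 1.  We define the array V for
-- an arbitrary adjacency, so that the transpose of U is again of this form.

diagCell : ℕ → ℕ → List ℕ
diagCell k i = i ∷ replicate (k ∸ 1) (k + 1)

offCell : ℕ → ℕ → ℕ → ℕ → List ℕ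
offCell k s h d = h ∷ (replicate (k ∸ s ∸ 1) d ++ fromTo (k + 3) (k + s + 2))

side₁Cell : ℕ → ℕ → List ℕ
side₁Cell k a = replicate (k ∸ 1) a ++ (k + 2 ∷ [])

sideCell : ℕ → ℕ → ℕ → List ℕ
sideCell k a t = if t ≡ᵇ k + 1 then side₁Cell k a else t ∷ Kminus k a

cornerCell : ℕ → (ℕ → ℕ → ℕ) → ℕ → ℕ → List ℕ
cornerCell k star x y =
  if star x y ≡ᵇ 1 then fromTo 1 k
  else if star x y ≡ᵇ 2 then replicate k (k + 1)
  else if x ≡ᵇ y then replicate k (k + 2)
  else replicate k (k + star x y)

KKCell : ℕ → ℕ → (ℕ → ℕ → ℕ) → (ℕ → ℕ → Bool) → ℕ → ℕ → List ℕ
KKCell k s circ adj i j =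
  if i ≡ᵇ j then diagCell k i
  else if adj i j then offCell k s (k + 1) (circ i j)
  else offCell k s (k + 2) (circ i j)

inK : ℕ → ℕ → Bool
inK k t = (1 ≤ᵇ t) ∧ (t ≤ᵇ k)

inK' : ℕ → ℕ → ℕ → Bool
inK' k s t = (k + 1 ≤ᵇ t) ∧ (t ≤ᵇ k + s + 2)

V : (k s : ℕ) → (circ star : ℕ → ℕ → ℕ) → (adj : ℕ → ℕ → Bool) → Array
V k s circ star adj i j =
  if inK k i ∧ inK k j then KKCell k s circ adj i j
  else if inK k i ∧ inK' k s j then sideCell k i j
  else if inK' k s i ∧ inK k j then sideCell k j i
  else if inK' k s i ∧ inK' k s j then cornerCell k star (i ∸ k) (j ∸ k)
  else []

next : ℕ → ℕ → ℕ
next k i = odot k i 1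

-- U k s circ star is, by definition, V k s circ star (adjU k): its adjacent
-- cells are those with i = j ⊙ 1.
adjU : ℕ → ℕ → ℕ → Bool
adjU k i j = i ≡ᵇ next k j

region : ∀ {k s j} → j ∈N (k + s + 2) → j ∈N k ⊎ Σ ℕ (λ y → y ∈N (s + 2) × j ≡ k + y)
region {k} {s} {j} (1≤j , j≤n) with j ≤? k
... | yes j≤k = inj₁ (1≤j , j≤k)
... | no j≰k  = inj₂ (j ∸ k , (m<n⇒0<n∸m k<j , y≤s+2) , sym (m+[n∸m]≡n (<⇒≤ k<j)))
  where
  k<j : k < j
  k<j = ≰⇒> j≰k
  y≤s+2 : j ∸ k ≤ s + 2
  y≤s+2 = ≤-trans (∸-monoˡ-≤ k j≤n) (≤-reflexive (trans (cong (_∸ k) (+-assoc k s 2)) (m+n∸m≡n k (s + 2))))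

K⊆N : ∀ {k s t} → t ∈N k → t ∈N (k + s + 2)
K⊆N {k} {s} (1≤t , t≤k) = 1≤t , ≤-trans t≤k (≤-trans (m≤m+n k s) (m≤m+n (k + s) 2))

K'⊆N : ∀ {k s y} → y ∈N (s + 2) → (k + y) ∈N (k + s + 2)
K'⊆N {k} {s} (1≤y , y≤s+2) = ≤-trans 1≤y (m≤n+m _ k) , ≤-trans (+-monoʳ-≤ k y≤s+2) (≤-reflexive (sym (+-assoc k s 2)))

k<k+y : ∀ {k y} → 1 ≤ y → k < k + y
k<k+y {k} 1≤y = ≤-trans (≤-reflexive (+-comm 1 k)) (+-monoʳ-≤ k 1≤y)

K<K' : ∀ {k i y} → i ∈N k → 1 ≤ y → i < k + y
K<K' (_ , i≤k) 1≤y = <-≤-trans (s≤s i≤k) (k<k+y 1≤y)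

K≢K' : ∀ {k i y} → i ∈N k → 1 ≤ y → i ≢ k + y
K≢K' i∈ 1≤y = <⇒≢ (K<K' i∈ 1≤y)

K'≢K' : ∀ {k a b} → a ≢ b → k + a ≢ k + b
K'≢K' {k} a≢b eq = a≢b (+-cancelˡ-≡ k _ _ eq)

inK-true : ∀ {k i} → i ∈N k → inK k i ≡ true
inK-true (1≤i , i≤k) rewrite ≤⇒≤ᵇ-true 1≤i | ≤⇒≤ᵇ-true i≤k = refl

inK-false : ∀ {k t} → k < t → inK k t ≡ false
inK-false {k} {t} k<t rewrite >⇒≤ᵇ-false k<t with 1 ≤ᵇ t
... | true  = refl
... | false = refl

inK'-true : ∀ {k s y} → y ∈N (s + 2) → inK' k s (k + y) ≡ true
inK'-true {k} {s} {y} (1≤y , y≤s+2)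
  rewrite ≤⇒≤ᵇ-true (+-monoʳ-≤ k 1≤y) | +-assoc k s 2 | ≤⇒≤ᵇ-true (+-monoʳ-≤ k y≤s+2) = refl

module Blocks (k s : ℕ) (circ star : ℕ → ℕ → ℕ) (adj : ℕ → ℕ → Bool) where

  V-KK : ∀ {i j} → i ∈N k → j ∈N k → V k s circ star adj i j ≡ KKCell k s circ adj i j
  V-KK i∈ j∈ rewrite inK-true i∈ | inK-true j∈ = refl

  V-KK' : ∀ {i y} → i ∈N k → y ∈N (s + 2) → V k s circ star adj i (k + y) ≡ sideCell k i (k + y)
  V-KK' {i} {y} i∈ y∈ rewrite inK-true i∈ | inK-false {k} {k + y} (k<k+y (proj₁ y∈))
                            | inK'-true {k} {s} y∈ = refl

  V-K'K : ∀ {y j} → y ∈N (s + 2) → j ∈N k → V k s circ star adj (k + y) j ≡ sideCell k j (k + y)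
  V-K'K {y} {j} y∈ j∈ rewrite inK-true j∈ | inK-false {k} {k + y} (k<k+y (proj₁ y∈))
                            | inK'-true {k} {s} y∈ = refl

  V-K'K' : ∀ {x y} → x ∈N (s + 2) → y ∈N (s + 2) → V k s circ star adj (k + x) (k + y) ≡ cornerCell k star x y
  V-K'K' {x} {y} x∈ y∈ rewrite inK-false {k} {k + x} (k<k+y (proj₁ x∈))
                             | inK-false {k} {k + y} (k<k+y (proj₁ y∈))
                             | inK'-true {k} {s} x∈ | inK'-true {k} {s} y∈ | m+n∸m≡n k x | m+n∸m≡n k y = refl

  KK-diag : ∀ i → KKCell k s circ adj i i ≡ diagCell k i
  KK-diag i rewrite ≡ᵇ-refl i = refl

  KK-adjacent : ∀ {i j} → i ≢ j → adj i j ≡ true → KKCell k s circ adj i j ≡ offCell k s (k + 1) (circ i j)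
  KK-adjacent i≢j adjacent rewrite ≢⇒≡ᵇ-false i≢j | adjacent = refl

  KK-far : ∀ {i j} → i ≢ j → adj i j ≡ false → KKCell k s circ adj i j ≡ offCell k s (k + 2) (circ i j)
  KK-far i≢j far rewrite ≢⇒≡ᵇ-false i≢j | far = refl

≢1⇒≥2 : ∀ {y} → 1 ≤ y → y ≢ 1 → 2 ≤ y
≢1⇒≥2 {suc zero}    _ y≢1 = ⊥-elim (y≢1 refl)
≢1⇒≥2 {suc (suc y)} _ _   = s≤s (s≤s z≤n)

sideCell-1 : ∀ k a → sideCell k a (k + 1) ≡ side₁Cell k a
sideCell-1 k a rewrite ≡ᵇ-refl (k + 1) = refl

sideCell-2 : ∀ k a {y} → 2 ≤ y → sideCell k a (k + y) ≡ (k + y) ∷ Kminus k a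
sideCell-2 k a 2≤y rewrite ≢⇒≡ᵇ-false (K'≢K' {k} (>⇒≢ 2≤y)) = refl

module _ {k : ℕ} where

  mult-diag-self : ∀ {a} → a ∈N k → mult a (diagCell k a) ≡ 1
  mult-diag-self {a} a∈ = trans (mult-here a (replicate (k ∸ 1) (k + 1)))
    (cong suc (mult-replicate-other (k ∸ 1) (K≢K' a∈ ≤-refl)))

  mult-diag-k+1 : ∀ {a} → a ∈N k → mult (k + 1) (diagCell k a) ≡ k ∸ 1
  mult-diag-k+1 {a} a∈ = trans (mult-there (replicate (k ∸ 1) (k + 1)) (≢-sym (K≢K' a∈ ≤-refl)))
    (mult-replicate-self (k ∸ 1) (k + 1))

  mult-diag-absent : ∀ {a x} → x ≢ a → x ≢ k + 1 → mult x (diagCell k a) ≡ 0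
  mult-diag-absent x≢a x≢k+1 = trans (mult-there (replicate (k ∸ 1) (k + 1)) x≢a) (mult-replicate-other (k ∸ 1) x≢k+1)

module _ (k s : ℕ) where

  private
    tail : List ℕ
    tail = fromTo (k + 3) (k + s + 2)

    tail-below : ∀ {x} → x ≤ k + 2 → mult x tail ≡ 0
    tail-below x≤k+2 = mult-fromTo-below {k + 3} {k + s + 2} (≤-trans (s≤s x≤k+2) (≤-reflexive (sym (+-suc k 2))))

  mult-off-absent : ∀ {h d x} → x ≢ h → x ≢ d → x ≤ k + 2 → mult x (offCell k s h d) ≡ 0
  mult-off-absent {h} {d} {x} x≢h x≢d x≤k+2 = trans (mult-there (replicate (k ∸ s ∸ 1) d ++ tail) x≢h)
    (trans (mult-++ x (replicate (k ∸ s ∸ 1) d) tail) (cong₂ _+_ (mult-replicate-other (k ∸ s ∸ 1) x≢d) (tail-below x≤k+2)))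

  mult-off-head : ∀ {h d} → h ≢ d → h ≤ k + 2 → mult h (offCell k s h d) ≡ 1
  mult-off-head {h} {d} h≢d h≤k+2 = trans (mult-here h (replicate (k ∸ s ∸ 1) d ++ tail))
    (cong suc (trans (mult-++ h (replicate (k ∸ s ∸ 1) d) tail)
      (cong₂ _+_ (mult-replicate-other (k ∸ s ∸ 1) h≢d) (tail-below h≤k+2))))

  mult-off-body : ∀ {h d} → d ≢ h → d ≤ k + 2 → mult d (offCell k s h d) ≡ k ∸ s ∸ 1
  mult-off-body {h} {d} d≢h d≤k+2 = trans (mult-there (replicate (k ∸ s ∸ 1) d ++ tail) d≢h)
    (trans (mult-++ d (replicate (k ∸ s ∸ 1) d) tail)
      (trans (cong₂ _+_ (mult-replicate-self (k ∸ s ∸ 1) d) (tail-below d≤k+2)) (+-identityʳ _)))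

  mult-off-tail : ∀ {h d z} → 3 ≤ z → z ≤ s + 2 → k + z ≢ h → k + z ≢ d → mult (k + z) (offCell k s h d) ≡ 1
  mult-off-tail {h} {d} {z} 3≤z z≤s+2 ≢h ≢d = trans (mult-there (replicate (k ∸ s ∸ 1) d ++ tail) ≢h)
    (trans (mult-++ (k + z) (replicate (k ∸ s ∸ 1) d) tail)
      (cong₂ _+_ (mult-replicate-other (k ∸ s ∸ 1) ≢d)
                 (mult-fromTo-in (+-monoʳ-≤ k 3≤z) (≤-trans (+-monoʳ-≤ k z≤s+2) (≤-reflexive (sym (+-assoc k s 2)))))))

module _ {k : ℕ} where

  mult-side₁-absent : ∀ {a x} → x ≢ a → x ≢ k + 2 → mult x (side₁Cell k a) ≡ 0
  mult-side₁-absent {a} {x} x≢a x≢k+2 = trans (mult-++ x (replicate (k ∸ 1) a) (k + 2 ∷ []))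
    (cong₂ _+_ (mult-replicate-other (k ∸ 1) x≢a) (mult-there [] x≢k+2))

  mult-side₁-self : ∀ {a} → a ≢ k + 2 → mult a (side₁Cell k a) ≡ k ∸ 1
  mult-side₁-self {a} a≢k+2 = trans (mult-++ a (replicate (k ∸ 1) a) (k + 2 ∷ []))
    (trans (cong₂ _+_ (mult-replicate-self (k ∸ 1) a) (mult-there [] a≢k+2)) (+-identityʳ _))

  mult-side₁-k+2 : ∀ {a} → a ≢ k + 2 → mult (k + 2) (side₁Cell k a) ≡ 1
  mult-side₁-k+2 {a} a≢k+2 = trans (mult-++ (k + 2) (replicate (k ∸ 1) a) (k + 2 ∷ []))
    (cong₂ _+_ (mult-replicate-other (k ∸ 1) (≢-sym a≢k+2)) (mult-here (k + 2) []))

  mult-side-head : ∀ {a y} → 1 ≤ y → mult (k + y) ((k + y) ∷ Kminus k a) ≡ 1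
  mult-side-head {a} {y} 1≤y = trans (mult-here (k + y) (Kminus k a)) (cong suc (mult-Kminus-above {k} {a} (k<k+y 1≤y)))

  mult-side-self : ∀ {a y} → a ∈N k → 1 ≤ y → mult a ((k + y) ∷ Kminus k a) ≡ 0
  mult-side-self {a} a∈ 1≤y = trans (mult-there (Kminus k a) (K≢K' a∈ 1≤y)) (mult-Kminus-self k a)

  mult-side-other : ∀ {a x y} → x ≢ a → x ∈N k → 1 ≤ y → mult x ((k + y) ∷ Kminus k a) ≡ 1
  mult-side-other {a} x≢a x∈ 1≤y = trans (mult-there (Kminus k a) (K≢K' x∈ 1≤y)) (mult-Kminus-other x≢a x∈)

  mult-side-above : ∀ {a y x} → a ≤ k → 1 ≤ y → k < x → (y ≡ 1 → x ≢ k + 2) → (2 ≤ y → x ≢ k + y) →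
                    mult x (sideCell k a (k + y)) ≡ 0
  mult-side-above {a} {y} {x} a≤k 1≤y k<x when1 when2 with y ≟ 1
  ... | yes refl rewrite sideCell-1 k a = mult-side₁-absent (>⇒≢ (≤-<-trans a≤k k<x)) (when1 refl)
  ... | no y≢1 rewrite sideCell-2 k a (≢1⇒≥2 1≤y y≢1) =
    trans (mult-there (Kminus k a) (when2 (≢1⇒≥2 1≤y y≢1))) (mult-Kminus-above {k} {a} k<x)

next-cases : ∀ {k j} → j ∈N k → (j < k × next k j ≡ suc j) ⊎ (j ≡ k × next k j ≡ 1)
next-cases {zero}  (1≤j , j≤0) = ⊥-elim (<⇒≱ 1≤j j≤0)
next-cases {suc k} {j} (_ , j≤k+1) with m≤n⇒m<n∨m≡n j≤k+1
... | inj₁ j<k+1 = inj₁ (j<k+1 , cong suc (trans (cong (_% suc k) (m+n∸n≡m j 1)) (m<n⇒m%n≡m j<k+1)))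
... | inj₂ refl  = inj₂ (refl , cong suc (trans (cong (_% suc k) (m+n∸n≡m (suc k) 1)) (n%n≡0 (suc k))))

next∈K : ∀ {k j} → j ∈N k → next k j ∈N k
next∈K {k} {j} j∈@(1≤j , _) with next-cases j∈
... | inj₁ (j<k , eq) rewrite eq = s≤s z≤n , j<k
... | inj₂ (refl , eq) rewrite eq = ≤-refl , 1≤j

next≢ : ∀ {k j} → 2 ≤ k → j ∈N k → next k j ≢ j
next≢ {k} {j} 2≤k j∈ with next-cases j∈
... | inj₁ (_ , eq) = λ eq′ → <⇒≢ (n<1+n j) (sym (trans (sym eq) eq′))
... | inj₂ (refl , eq) = λ eq′ → <⇒≢ 2≤k (trans (sym eq) eq′)

next-injective : ∀ {k i j} → i ∈N k → j ∈N k → next k i ≡ next k j → i ≡ j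
next-injective i∈ j∈ eq with next-cases i∈ | next-cases j∈
... | inj₁ (_ , ei) | inj₁ (_ , ej) = suc-injective (trans (sym ei) (trans eq ej))
... | inj₂ (i≡k , _) | inj₂ (j≡k , _) = trans i≡k (sym j≡k)
... | inj₁ (_ , ei) | inj₂ (_ , ej) = ⊥-elim (<⇒≢ (proj₁ i∈) (sym (suc-injective (trans (sym ei) (trans eq ej)))))
... | inj₂ (_ , ei) | inj₁ (_ , ej) = ⊥-elim (<⇒≢ (proj₁ j∈) (suc-injective (trans (sym ei) (trans eq ej))))

next-surjective : ∀ {k i} → i ∈N k → ∃[ p ] (p ∈N k × next k p ≡ i)
next-surjective {k} {suc zero} (_ , 1≤k) with next-cases {k} {k} (1≤k , ≤-refl)
... | inj₁ (k<k , _) = ⊥-elim (<-irrefl refl k<k)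
... | inj₂ (_ , eq)  = k , (1≤k , ≤-refl) , eq
next-surjective {k} {suc (suc m)} (_ , m+2≤k) with next-cases {k} {suc m} (s≤s z≤n , <⇒≤ m+2≤k)
... | inj₁ (_ , eq)     = suc m , (s≤s z≤n , <⇒≤ m+2≤k) , eq
... | inj₂ (m+1≡k , _) = ⊥-elim (<⇒≢ m+2≤k m+1≡k)

record Partner (k : ℕ) (adj : ℕ → ℕ → Bool) (i : ℕ) : Set where
  field
    partner    : ℕ
    partner∈K  : partner ∈N k
    partner≢i  : partner ≢ i
    adjacent   : adj i partner ≡ true
    others-far : ∀ j → j ∈N k → j ≢ i → j ≢ partner → adj i j ≡ false

HasPartners : ℕ → (ℕ → ℕ → Bool) → Set
HasPartners k adj = ∀ i → i ∈N k → Partner k adj i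

-- For U the partner of i is its predecessor.
partners-U : ∀ {k} → 2 ≤ k → HasPartners k (adjU k)
partners-U {k} 2≤k i i∈ with next-surjective i∈
... | p , p∈ , next-p≡i = record
  { partner = p ; partner∈K = p∈
  ; partner≢i = λ p≡i → next≢ 2≤k p∈ (trans next-p≡i (sym p≡i))
  ; adjacent = subst (λ t → (i ≡ᵇ t) ≡ true) (sym next-p≡i) (≡ᵇ-refl i)
  ; others-far = λ j j∈ _ j≢p → ≢⇒≡ᵇ-false λ i≡next-j →
      j≢p (next-injective j∈ p∈ (trans (sym i≡next-j) (sym next-p≡i)))
  }

adjUᵀ : ℕ → ℕ → ℕ → Bool
adjUᵀ k i j = j ≡ᵇ next k i

partners-Uᵀ : ∀ {k} → 2 ≤ k → HasPartners k (adjUᵀ k)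
partners-Uᵀ {k} 2≤k i i∈ = record
  { partner = next k i ; partner∈K = next∈K i∈ ; partner≢i = next≢ 2≤k i∈
  ; adjacent = ≡ᵇ-refl (next k i) ; others-far = λ j _ _ j≢p → ≢⇒≡ᵇ-false j≢p }

module RowCounts (k s : ℕ) (s<k : s < k) (circ star : ℕ → ℕ → ℕ) (adj : ℕ → ℕ → Bool)
                 (Q : IsIdempotentQuasigroup k circ) (S : IsIdempotentQuasigroup (s + 2) star)
                 (partners : HasPartners k adj) where

  open Blocks k s circ star adj
  module Q = IsIdempotentQuasigroup Q
  module S = IsIdempotentQuasigroup S

  n : ℕ
  n = k + s + 2

  W : Array
  W = V k s circ star adj

  -- the number of copies of i ∘ j in an off-diagonal K×K cell
  c : ℕ
  c = k ∸ s ∸ 1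

  c+s+1≡k : c + (s + 1) ≡ k
  c+s+1≡k = trans (cong (_+ (s + 1)) (∸-+-assoc k s 1)) (m∸n+n≡m (≤-trans (≤-reflexive (+-comm s 1)) s<k))

  k∸1+1≡k : k ∸ 1 + 1 ≡ k
  k∸1+1≡k = m∸n+n≡m (≤-trans (s≤s z≤n) s<k)

  row-split : ∀ (f : ℕ → ℕ) → sumTo n f ≡ sumTo k f + sumTo (s + 2) (λ y → f (k + y))
  row-split f rewrite +-assoc k s 2 = sum-split k (s + 2) f

  1∈K' : 1 ∈N (s + 2)
  1∈K' = ≤-refl , ≤-trans (s≤s z≤n) (m≤n+m 2 s)

  2∈K' : 2 ∈N (s + 2)
  2∈K' = s≤s z≤n , m≤n+m 2 s

  ≤k+2 : ∀ {x} → x ∈N k → x ≤ k + 2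
  ≤k+2 (_ , x≤k) = ≤-trans x≤k (m≤m+n k 2)

  k+1≢k+2 : k + 1 ≢ k + 2
  k+1≢k+2 = K'≢K' {k} {1} {2} (λ ())

  row-total : ∀ x r {b} → sumTo (s + 2) (λ y → mult x (W r (k + y))) ≡ b →
              sumTo k (λ j → mult x (W r j)) + b ≡ k → sumTo n (λ j → mult x (W r j)) ≡ k
  row-total x r K'-part total = trans (row-split _) (trans (cong (sumTo k (λ j → mult x (W r j)) +_) K'-part) total)

  by-cell : ∀ {x v} {cell l : List ℕ} → cell ≡ l → mult x l ≡ v → mult x cell ≡ v
  by-cell {x} eq m = trans (cong (mult x) eq) m

  -- i ∘ j ≠ i for j ≠ i, since i ∘ i = i.
  circ≢ : ∀ {i j} → i ∈N k → j ∈N k → j ≢ i → circ i j ≢ i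
  circ≢ {i} {j} i∈ j∈ j≢i eq = j≢i (Q.leftCancel i j i i∈ j∈ i∈ (trans eq (sym (Q.idempotent i i∈))))

  cell-diag : ∀ {i} → i ∈N k → W i i ≡ diagCell k i
  cell-diag {i} i∈ = trans (V-KK i∈ i∈) (KK-diag i)

  cell-adjacent : ∀ {i} (i∈ : i ∈N k) → let p = Partner.partner (partners i i∈) in
                  W i p ≡ offCell k s (k + 1) (circ i p)
  cell-adjacent {i} i∈ = trans (V-KK i∈ partner∈K) (KK-adjacent (≢-sym partner≢i) adjacent)
    where open Partner (partners i i∈)

  cell-far : ∀ {i j} (i∈ : i ∈N k) → j ∈N k → j ≢ i → j ≢ Partner.partner (partners i i∈) →
             W i j ≡ offCell k s (k + 2) (circ i j)
  cell-far {i} {j} i∈ j∈ j≢i j≢p =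
    trans (V-KK i∈ j∈) (KK-far (≢-sym j≢i) (Partner.others-far (partners i i∈) j j∈ j≢i j≢p))

  cell-off : ∀ {i j} → i ∈N k → j ∈N k → j ≢ i →
             ∃[ h ] (k < h × h ≤ k + 2 × W i j ≡ offCell k s h (circ i j))
  cell-off {i} {j} i∈ j∈ j≢i with j ≟ Partner.partner (partners i i∈)
  ... | yes refl = k + 1 , k<k+y ≤-refl , +-monoʳ-≤ k (s≤s z≤n) , cell-adjacent i∈
  ... | no j≢p   = k + 2 , k<k+y (s≤s z≤n) , ≤-refl , cell-far i∈ j∈ j≢i j≢p

  cell-side₁ : ∀ {i} → i ∈N k → W i (k + 1) ≡ side₁Cell k i
  cell-side₁ {i} i∈ = trans (V-KK' i∈ 1∈K') (sideCell-1 k i)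

  cell-side₂ : ∀ {i y} → i ∈N k → y ∈N (s + 2) → 2 ≤ y → W i (k + y) ≡ (k + y) ∷ Kminus k i
  cell-side₂ {i} i∈ y∈ 2≤y = trans (V-KK' i∈ y∈) (sideCell-2 k i 2≤y)

  cell-side₁ᵀ : ∀ {j} → j ∈N k → W (k + 1) j ≡ side₁Cell k j
  cell-side₁ᵀ {j} j∈ = trans (V-K'K 1∈K' j∈) (sideCell-1 k j)

  cell-side₂ᵀ : ∀ {w j} → w ∈N (s + 2) → 2 ≤ w → j ∈N k → W (k + w) j ≡ (k + w) ∷ Kminus k j
  cell-side₂ᵀ {w} {j} w∈ 2≤w j∈ = trans (V-K'K w∈ j∈) (sideCell-2 k j 2≤w)

  -- Symbol i in row i: once on the diagonal and k-1 times in column k+1.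
  row-K-self : ∀ {i} → i ∈N k → sumTo n (λ j → mult i (W i j)) ≡ k
  row-K-self {i} i∈ = row-total i i K'-part (trans (cong (_+ (k ∸ 1)) K-part) (trans (+-comm 1 (k ∸ 1)) k∸1+1≡k))
    where
    off : ∀ j → j ∈N k → j ≢ i → mult i (W i j) ≡ 0
    off j j∈ j≢i with cell-off i∈ j∈ j≢i
    ... | h , k<h , _ , eq = by-cell eq
            (mult-off-absent k s (<⇒≢ (≤-<-trans (proj₂ i∈) k<h)) (≢-sym (circ≢ i∈ j∈ j≢i)) (≤k+2 i∈))
    K-part : sumTo k (λ j → mult i (W i j)) ≡ 1
    K-part = trans (sum-one k i i∈ off) (by-cell (cell-diag i∈) (mult-diag-self i∈))
    side : ∀ y → y ∈N (s + 2) → y ≢ 1 → mult i (W i (k + y)) ≡ 0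
    side y y∈ y≢1 = by-cell (cell-side₂ i∈ y∈ (≢1⇒≥2 (proj₁ y∈) y≢1)) (mult-side-self i∈ (proj₁ y∈))
    K'-part : sumTo (s + 2) (λ y → mult i (W i (k + y))) ≡ k ∸ 1
    K'-part = trans (sum-one (s + 2) 1 1∈K' side) (by-cell (cell-side₁ i∈) (mult-side₁-self (K≢K' i∈ (s≤s z≤n))))

  -- Symbol x ≠ i of K in row i: k-s-1 times in the cell (i, j₀) with
  -- i ∘ j₀ = x, and once in each column k+y with y ≥ 2.
  row-K-other : ∀ {i x} → i ∈N k → x ∈N k → x ≢ i → sumTo n (λ j → mult x (W i j)) ≡ k
  row-K-other {i} {x} i∈ x∈ x≢i = row-total x i K'-part (trans (cong (_+ (s + 1)) K-part) c+s+1≡k)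
    where
    j₀ : ℕ
    j₀ = proj₁ (Q.leftDiv i x i∈ x∈)
    j₀∈ : j₀ ∈N k
    j₀∈ = proj₁ (proj₂ (Q.leftDiv i x i∈ x∈))
    i∘j₀≡x : circ i j₀ ≡ x
    i∘j₀≡x = proj₂ (proj₂ (Q.leftDiv i x i∈ x∈))
    j₀≢i : j₀ ≢ i
    j₀≢i j₀≡i = x≢i (trans (sym i∘j₀≡x) (trans (cong (circ i) j₀≡i) (Q.idempotent i i∈)))
    at-j₀ : mult x (W i j₀) ≡ c
    at-j₀ with cell-off i∈ j₀∈ j₀≢i
    ... | h , k<h , _ , eq = by-cell eq (subst (λ t → mult t (offCell k s h (circ i j₀)) ≡ c) i∘j₀≡x
            (mult-off-body k s (<⇒≢ (≤-<-trans (proj₂ i∘j₀∈) k<h)) (≤k+2 i∘j₀∈)))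
      where
      i∘j₀∈ : circ i j₀ ∈N k
      i∘j₀∈ = Q.closed i j₀ i∈ j₀∈
    elsewhere : ∀ j → j ∈N k → j ≢ j₀ → mult x (W i j) ≡ 0
    elsewhere j j∈ j≢j₀ with j ≟ i
    ... | yes refl = by-cell (cell-diag i∈) (mult-diag-absent x≢i (K≢K' x∈ ≤-refl))
    ... | no j≢i with cell-off i∈ j∈ j≢i
    ... | h , k<h , _ , eq = by-cell eq (mult-off-absent k s (<⇒≢ (≤-<-trans (proj₂ x∈) k<h))
            (λ x≡i∘j → j≢j₀ (Q.leftCancel i j j₀ i∈ j∈ j₀∈ (trans (sym x≡i∘j) (sym i∘j₀≡x)))) (≤k+2 x∈))
    K-part : sumTo k (λ j → mult x (W i j)) ≡ c
    K-part = trans (sum-one k j₀ j₀∈ elsewhere) at-j₀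
    side : ∀ y → y ∈N (s + 2) → y ≢ 1 → mult x (W i (k + y)) ≡ 1
    side y y∈ y≢1 = by-cell (cell-side₂ i∈ y∈ (≢1⇒≥2 (proj₁ y∈) y≢1)) (mult-side-other x≢i x∈ (proj₁ y∈))
    K'-part : sumTo (s + 2) (λ y → mult x (W i (k + y))) ≡ s + 1
    K'-part = +-cancelʳ-≡ 1 _ _ (trans (sum-ones-but-one (s + 2) 1 1∈K'
                (by-cell (cell-side₁ i∈) (mult-side₁-absent x≢i (K≢K' x∈ (s≤s z≤n)))) side) (sym (+-assoc s 1 1)))

  -- Symbol k+1 in row i: k-1 times on the diagonal and once in the partner cell.
  row-K-k+1 : ∀ {i} → i ∈N k → sumTo n (λ j → mult (k + 1) (W i j)) ≡ k
  row-K-k+1 {i} i∈ = row-total (k + 1) i K'-part (trans (+-identityʳ _) (trans K-part k∸1+1≡k))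
    where
    open Partner (partners i i∈)
    i∘p∈ : circ i partner ∈N k
    i∘p∈ = Q.closed i partner i∈ partner∈K
    far : ∀ j → j ∈N k → j ≢ i → j ≢ partner → mult (k + 1) (W i j) ≡ 0
    far j j∈ j≢i j≢p = by-cell (cell-far i∈ j∈ j≢i j≢p)
      (mult-off-absent k s k+1≢k+2 (≢-sym (K≢K' (Q.closed i j i∈ j∈) ≤-refl)) (+-monoʳ-≤ k (s≤s z≤n)))
    K-part : sumTo k (λ j → mult (k + 1) (W i j)) ≡ k ∸ 1 + 1
    K-part = trans (sum-two k i partner i∈ partner∈K (≢-sym partner≢i) far)
      (cong₂ _+_ (by-cell (cell-diag i∈) (mult-diag-k+1 i∈))
                 (by-cell (cell-adjacent i∈) (mult-off-head k s (≢-sym (K≢K' i∘p∈ ≤-refl)) (+-monoʳ-≤ k (s≤s z≤n)))))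
    K'-part : sumTo (s + 2) (λ y → mult (k + 1) (W i (k + y))) ≡ 0
    K'-part = sum-zero (s + 2) λ y y∈ → by-cell (V-KK' i∈ y∈)
      (mult-side-above (proj₂ i∈) (proj₁ y∈) (k<k+y ≤-refl) (λ _ → k+1≢k+2) (λ 2≤y → K'≢K' (<⇒≢ 2≤y)))

  -- Symbol k+2 in row i: once in every far cell (k-2 of them) and once in
  -- each of the columns k+1 and k+2.
  row-K-k+2 : ∀ {i} → i ∈N k → sumTo n (λ j → mult (k + 2) (W i j)) ≡ k
  row-K-k+2 {i} i∈ = row-total (k + 2) i K'-part K-part
    where
    open Partner (partners i i∈)
    i∘p∈ : circ i partner ∈N k
    i∘p∈ = Q.closed i partner i∈ partner∈K
    far : ∀ j → j ∈N k → j ≢ i → j ≢ partner → mult (k + 2) (W i j) ≡ 1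
    far j j∈ j≢i j≢p = by-cell (cell-far i∈ j∈ j≢i j≢p)
      (mult-off-head k s (≢-sym (K≢K' (Q.closed i j i∈ j∈) (s≤s z≤n))) ≤-refl)
    K-part : sumTo k (λ j → mult (k + 2) (W i j)) + 2 ≡ k
    K-part = sum-ones-but-two k i partner i∈ partner∈K (≢-sym partner≢i)
      (by-cell (cell-diag i∈) (mult-diag-absent (≢-sym (K≢K' i∈ (s≤s z≤n))) (≢-sym k+1≢k+2)))
      (by-cell (cell-adjacent i∈) (mult-off-absent k s (≢-sym k+1≢k+2) (≢-sym (K≢K' i∘p∈ (s≤s z≤n))) ≤-refl))
      far
    others : ∀ y → y ∈N (s + 2) → y ≢ 1 → y ≢ 2 → mult (k + 2) (W i (k + y)) ≡ 0
    others y y∈ y≢1 y≢2 = by-cell (V-KK' i∈ y∈)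
      (mult-side-above (proj₂ i∈) (proj₁ y∈) (k<k+y (s≤s z≤n)) (λ y≡1 → ⊥-elim (y≢1 y≡1)) (λ _ → K'≢K' (≢-sym y≢2)))
    K'-part : sumTo (s + 2) (λ y → mult (k + 2) (W i (k + y))) ≡ 2
    K'-part = trans (sum-two (s + 2) 1 2 1∈K' 2∈K' (λ ()) others)
      (cong₂ _+_ (by-cell (cell-side₁ i∈) (mult-side₁-k+2 (K≢K' i∈ (s≤s z≤n))))
                 (by-cell (cell-side₂ i∈ 2∈K' ≤-refl) (mult-side-head {k} {i} (s≤s z≤n))))

  -- Symbol k+z (z ≥ 3) in row i: once in every off-diagonal K-cell and once in column k+z.
  row-K-beyond : ∀ {i z} → i ∈N k → 3 ≤ z → z ≤ s + 2 → sumTo n (λ j → mult (k + z) (W i j)) ≡ k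
  row-K-beyond {i} {z} i∈ 3≤z z≤s+2 = row-total (k + z) i K'-part K-part
    where
    1≤z : 1 ≤ z
    1≤z = ≤-trans (s≤s z≤n) 3≤z
    off : ∀ j → j ∈N k → j ≢ i → mult (k + z) (W i j) ≡ 1
    off j j∈ j≢i with cell-off i∈ j∈ j≢i
    ... | h , _ , h≤k+2 , eq = by-cell eq (mult-off-tail k s 3≤z z≤s+2
            (>⇒≢ (≤-<-trans h≤k+2 (+-monoʳ-< k 3≤z))) (≢-sym (K≢K' (Q.closed i j i∈ j∈) 1≤z)))
    K-part : sumTo k (λ j → mult (k + z) (W i j)) + 1 ≡ k
    K-part = sum-ones-but-one k i i∈
      (by-cell (cell-diag i∈) (mult-diag-absent (≢-sym (K≢K' i∈ 1≤z)) (K'≢K' (>⇒≢ (≤-trans (s≤s (s≤s z≤n)) 3≤z))))) off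
    others : ∀ y → y ∈N (s + 2) → y ≢ z → mult (k + z) (W i (k + y)) ≡ 0
    others y y∈ y≢z = by-cell (V-KK' i∈ y∈)
      (mult-side-above (proj₂ i∈) (proj₁ y∈) (k<k+y 1≤z) (λ _ → K'≢K' (>⇒≢ 3≤z)) (λ _ → K'≢K' (≢-sym y≢z)))
    K'-part : sumTo (s + 2) (λ y → mult (k + z) (W i (k + y))) ≡ 1
    K'-part = trans (sum-one (s + 2) z (1≤z , z≤s+2) others)
      (by-cell (cell-side₂ i∈ (1≤z , z≤s+2) (≤-trans (s≤s (s≤s z≤n)) 3≤z)) (mult-side-head {k} {i} 1≤z))

  cell-corner : ∀ {w y} → w ∈N (s + 2) → y ∈N (s + 2) → W (k + w) (k + y) ≡ cornerCell k star w y
  cell-corner = V-K'K'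

  module _ {w y : ℕ} (w∈ : w ∈N (s + 2)) (y∈ : y ∈N (s + 2)) where

    corner-K : star w y ≡ 1 → W (k + w) (k + y) ≡ fromTo 1 k
    corner-K eq rewrite cell-corner w∈ y∈ | eq = refl

    corner-k+1 : star w y ≡ 2 → W (k + w) (k + y) ≡ replicate k (k + 1)
    corner-k+1 eq rewrite cell-corner w∈ y∈ | eq = refl

    corner-k+2 : star w y ≢ 1 → star w y ≢ 2 → w ≡ y → W (k + w) (k + y) ≡ replicate k (k + 2)
    corner-k+2 ≢1 ≢2 refl rewrite cell-corner w∈ y∈ | ≢⇒≡ᵇ-false ≢1 | ≢⇒≡ᵇ-false ≢2 | ≡ᵇ-refl w = refl

    corner-k+⋆ : star w y ≢ 1 → star w y ≢ 2 → w ≢ y → W (k + w) (k + y) ≡ replicate k (k + star w y)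
    corner-k+⋆ ≢1 ≢2 w≢y rewrite cell-corner w∈ y∈ | ≢⇒≡ᵇ-false ≢1 | ≢⇒≡ᵇ-false ≢2 | ≢⇒≡ᵇ-false w≢y = refl

    corner-absent : ∀ {t} → (star w y ≡ 1 → k < t) → (star w y ≡ 2 → t ≢ k + 1) →
                    (star w y ≢ 1 → star w y ≢ 2 → w ≡ y → t ≢ k + 2) →
                    (star w y ≢ 1 → star w y ≢ 2 → w ≢ y → t ≢ k + star w y) →
                    mult t (W (k + w) (k + y)) ≡ 0
    corner-absent when1 when2 when-diag when-off with star w y ≟ 1 | star w y ≟ 2 | w ≟ y
    ... | yes ≡1 | _      | _        = by-cell (corner-K ≡1) (mult-fromTo-above {1} (when1 ≡1))
    ... | no ≢1  | yes ≡2 | _        = by-cell (corner-k+1 ≡2) (mult-replicate-other k (when2 ≡2))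
    ... | no ≢1  | no ≢2  | yes w≡y  = by-cell (corner-k+2 ≢1 ≢2 w≡y) (mult-replicate-other k (when-diag ≢1 ≢2 w≡y))
    ... | no ≢1  | no ≢2  | no w≢y   = by-cell (corner-k+⋆ ≢1 ≢2 w≢y) (mult-replicate-other k (when-off ≢1 ≢2 w≢y))

  module Solve {w t : ℕ} (w∈ : w ∈N (s + 2)) (t∈ : t ∈N (s + 2)) where
    y₀ : ℕ
    y₀ = proj₁ (S.leftDiv w t w∈ t∈)
    y₀∈ : y₀ ∈N (s + 2)
    y₀∈ = proj₁ (proj₂ (S.leftDiv w t w∈ t∈))
    w⋆y₀≡t : star w y₀ ≡ t
    w⋆y₀≡t = proj₂ (proj₂ (S.leftDiv w t w∈ t∈))
    w⋆y≢t : ∀ {y} → y ∈N (s + 2) → y ≢ y₀ → star w y ≢ t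
    w⋆y≢t y∈ y≢y₀ eq = y≢y₀ (S.leftCancel w _ y₀ w∈ y∈ y₀∈ (trans eq (sym w⋆y₀≡t)))

  K-part-absent : ∀ {w x} → w ∈N (s + 2) → k < x → (w ≡ 1 → x ≢ k + 2) → (2 ≤ w → x ≢ k + w) →
                  sumTo k (λ j → mult x (W (k + w) j)) ≡ 0
  K-part-absent w∈ k<x when1 when2 =
    sum-zero k λ j j∈ → by-cell (V-K'K w∈ j∈) (mult-side-above (proj₂ j∈) (proj₁ w∈) k<x when1 when2)

  -- Symbol x ∈ K in row k+w: k-1 times in the K part, and once in the
  -- corner cell (k+w, k+y₀) with w ⋆ y₀ = 1, which is K.
  row-K'-K : ∀ {w x} → w ∈N (s + 2) → x ∈N k → sumTo n (λ j → mult x (W (k + w) j)) ≡ k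
  row-K'-K {w} {x} w∈ x∈ = row-total x (k + w) K'-part K-part
    where
    open Solve w∈ 1∈K'
    others : ∀ y → y ∈N (s + 2) → y ≢ y₀ → mult x (W (k + w) (k + y)) ≡ 0
    others y y∈ y≢y₀ = corner-absent w∈ y∈ (λ w⋆y≡1 → ⊥-elim (w⋆y≢t y∈ y≢y₀ w⋆y≡1))
      (λ _ → K≢K' x∈ ≤-refl) (λ _ _ _ → K≢K' x∈ (s≤s z≤n)) (λ _ _ _ → K≢K' x∈ (proj₁ (S.closed w y w∈ y∈)))
    K'-part : sumTo (s + 2) (λ y → mult x (W (k + w) (k + y))) ≡ 1
    K'-part = trans (sum-one (s + 2) y₀ y₀∈ others)
      (by-cell (corner-K w∈ y₀∈ w⋆y₀≡t) (mult-fromTo-in (proj₁ x∈) (proj₂ x∈)))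
    K-part : sumTo k (λ j → mult x (W (k + w) j)) + 1 ≡ k
    K-part with w ≟ 1
    ... | yes refl = trans (cong (_+ 1) (sum-one k x x∈ λ j j∈ j≢x → by-cell (cell-side₁ᵀ j∈)
                       (mult-side₁-absent (≢-sym j≢x) (K≢K' x∈ (s≤s z≤n)))))
                       (trans (cong (_+ 1) (by-cell (cell-side₁ᵀ x∈) (mult-side₁-self (K≢K' x∈ (s≤s z≤n))))) k∸1+1≡k)
    ... | no w≢1 = sum-ones-but-one k x x∈ (by-cell (cell-side₂ᵀ w∈ 2≤w x∈) (mult-side-self x∈ (proj₁ w∈)))
                     λ j j∈ j≢x → by-cell (cell-side₂ᵀ w∈ 2≤w j∈) (mult-side-other (≢-sym j≢x) x∈ (proj₁ w∈))
      where
      2≤w : 2 ≤ w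
      2≤w = ≢1⇒≥2 (proj₁ w∈) w≢1

  -- Symbol k+1 in row k+w: only in the corner cell (k+w, k+y₀) with w ⋆ y₀ = 2.
  row-K'-k+1 : ∀ {w} → w ∈N (s + 2) → sumTo n (λ j → mult (k + 1) (W (k + w) j)) ≡ k
  row-K'-k+1 {w} w∈ = row-total (k + 1) (k + w) K'-part (cong (_+ k) K-part)
    where
    open Solve w∈ 2∈K'
    K-part : sumTo k (λ j → mult (k + 1) (W (k + w) j)) ≡ 0
    K-part = K-part-absent w∈ (k<k+y ≤-refl) (λ _ → k+1≢k+2) (λ 2≤w → K'≢K' (<⇒≢ 2≤w))
    others : ∀ y → y ∈N (s + 2) → y ≢ y₀ → mult (k + 1) (W (k + w) (k + y)) ≡ 0
    others y y∈ y≢y₀ = corner-absent w∈ y∈ (λ _ → k<k+y ≤-refl)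
      (λ w⋆y≡2 → ⊥-elim (w⋆y≢t y∈ y≢y₀ w⋆y≡2)) (λ _ _ _ → k+1≢k+2) (λ w⋆y≢1 _ _ → K'≢K' (≢-sym w⋆y≢1))
    K'-part : sumTo (s + 2) (λ y → mult (k + 1) (W (k + w) (k + y))) ≡ k
    K'-part = trans (sum-one (s + 2) y₀ y₀∈ others)
      (by-cell (corner-k+1 w∈ y₀∈ w⋆y₀≡t) (mult-replicate-self k (k + 1)))

  corner-no-k+2 : ∀ {w y} → w ∈N (s + 2) → y ∈N (s + 2) → (star w y ≢ 1 → star w y ≢ 2 → w ≢ y) →
                  mult (k + 2) (W (k + w) (k + y)) ≡ 0
  corner-no-k+2 w∈ y∈ off-diagonal = corner-absent w∈ y∈ (λ _ → k<k+y (s≤s z≤n)) (λ _ → ≢-sym k+1≢k+2)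
    (λ ≢1 ≢2 w≡y → ⊥-elim (off-diagonal ≢1 ≢2 w≡y)) (λ _ ≢2 _ → K'≢K' (≢-sym ≢2))

  -- Symbol k+2 in row k+w: in every side cell if w ≤ 2, otherwise in the
  -- corner cell (k+w, k+w) = (k+2)^k.
  row-K'-k+2 : ∀ {w} → w ∈N (s + 2) → sumTo n (λ j → mult (k + 2) (W (k + w) j)) ≡ k
  row-K'-k+2 {w} w∈ = trans (row-split _) parts
    where
    w⋆w≡w : star w w ≡ w
    w⋆w≡w = S.idempotent w w∈
    parts : sumTo k (λ j → mult (k + 2) (W (k + w) j)) + sumTo (s + 2) (λ y → mult (k + 2) (W (k + w) (k + y))) ≡ k
    parts with w ≟ 1 | w ≟ 2
    ... | yes refl | _ = trans (cong₂ _+_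
            (sum-all-ones k λ j j∈ → by-cell (cell-side₁ᵀ j∈) (mult-side₁-k+2 (K≢K' j∈ (s≤s z≤n))))
            (sum-zero (s + 2) λ y y∈ → corner-no-k+2 w∈ y∈ λ ≢1 _ w≡y → ≢1 (trans (cong (star 1) (sym w≡y)) w⋆w≡w)))
          (+-identityʳ k)
    ... | no _ | yes refl = trans (cong₂ _+_
            (sum-all-ones k λ j j∈ → by-cell (cell-side₂ᵀ w∈ ≤-refl j∈) (mult-side-head {k} {j} (s≤s z≤n)))
            (sum-zero (s + 2) λ y y∈ → corner-no-k+2 w∈ y∈ λ _ ≢2 w≡y → ≢2 (trans (cong (star 2) (sym w≡y)) w⋆w≡w)))
          (+-identityʳ k)
    ... | no w≢1 | no w≢2 = cong₂ _+_
            (K-part-absent w∈ (k<k+y (s≤s z≤n)) (λ w≡1 → ⊥-elim (w≢1 w≡1)) (λ _ → K'≢K' (≢-sym w≢2)))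
            (trans (sum-one (s + 2) w w∈ λ y y∈ y≢w → corner-no-k+2 w∈ y∈ λ _ _ w≡y → y≢w (sym w≡y))
              (by-cell (corner-k+2 w∈ w∈ (λ eq → w≢1 (trans (sym w⋆w≡w) eq)) (λ eq → w≢2 (trans (sym w⋆w≡w) eq)) refl)
                       (mult-replicate-self k (k + 2))))

  -- Symbol k+z (z ≥ 3) in row k+w: in every side cell if z = w, otherwise
  -- in the corner cell (k+w, k+y₀) with w ⋆ y₀ = z.
  row-K'-beyond : ∀ {w z} → w ∈N (s + 2) → 3 ≤ z → z ≤ s + 2 → sumTo n (λ j → mult (k + z) (W (k + w) j)) ≡ k
  row-K'-beyond {w} {z} w∈ 3≤z z≤s+2 = trans (row-split _) parts
    where
    z∈ : z ∈N (s + 2)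
    z∈ = ≤-trans (s≤s z≤n) 3≤z , z≤s+2
    z≢1 : z ≢ 1
    z≢1 = >⇒≢ (≤-trans (s≤s (s≤s z≤n)) 3≤z)
    z≢2 : z ≢ 2
    z≢2 = >⇒≢ 3≤z
    corner-no-k+z : ∀ {y} → y ∈N (s + 2) → (star w y ≢ 1 → star w y ≢ 2 → w ≢ y → star w y ≢ z) →
                    mult (k + z) (W (k + w) (k + y)) ≡ 0
    corner-no-k+z y∈ w⋆y≢z = corner-absent w∈ y∈ (λ _ → k<k+y (proj₁ z∈)) (λ _ → K'≢K' z≢1) (λ _ _ _ → K'≢K' z≢2)
      (λ ≢1 ≢2 w≢y → K'≢K' (≢-sym (w⋆y≢z ≢1 ≢2 w≢y)))
    parts : sumTo k (λ j → mult (k + z) (W (k + w) j)) + sumTo (s + 2) (λ y → mult (k + z) (W (k + w) (k + y))) ≡ k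
    parts with z ≟ w
    ... | yes refl = trans (cong₂ _+_
            (sum-all-ones k λ j j∈ → by-cell (cell-side₂ᵀ w∈ (≢1⇒≥2 (proj₁ z∈) z≢1) j∈)
                                              (mult-side-head {k} {j} (proj₁ z∈)))
            (sum-zero (s + 2) λ y y∈ → corner-no-k+z y∈ λ _ _ z≢y z⋆y≡z →
              z≢y (S.leftCancel z z y z∈ z∈ y∈ (trans (S.idempotent z z∈) (sym z⋆y≡z)))))
          (+-identityʳ k)
    ... | no z≢w = cong₂ _+_ K-part K'-part
      where
      open Solve w∈ z∈
      w≢y₀ : w ≢ y₀
      w≢y₀ w≡y₀ = z≢w (trans (sym w⋆y₀≡t) (trans (cong (star w) (sym w≡y₀)) (S.idempotent w w∈)))
      K-part : sumTo k (λ j → mult (k + z) (W (k + w) j)) ≡ 0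
      K-part = K-part-absent w∈ (k<k+y (proj₁ z∈)) (λ _ → K'≢K' z≢2) (λ _ → K'≢K' z≢w)
      at-y₀ : mult (k + z) (W (k + w) (k + y₀)) ≡ k
      at-y₀ = by-cell (corner-k+⋆ w∈ y₀∈ (λ eq → z≢1 (trans (sym w⋆y₀≡t) eq)) (λ eq → z≢2 (trans (sym w⋆y₀≡t) eq)) w≢y₀)
                (subst (λ t → mult (k + z) (replicate k (k + t)) ≡ k) (sym w⋆y₀≡t) (mult-replicate-self k (k + z)))
      K'-part : sumTo (s + 2) (λ y → mult (k + z) (W (k + w) (k + y))) ≡ k
      K'-part = trans (sum-one (s + 2) y₀ y₀∈ λ y y∈ y≢y₀ → corner-no-k+z y∈ λ _ _ _ → w⋆y≢t y∈ y≢y₀) at-y₀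

  by-symbol : ∀ {z} (P : ℕ → Set) → z ∈N (s + 2) → P 1 → P 2 → (∀ {z} → 3 ≤ z → z ≤ s + 2 → P z) → P z
  by-symbol {suc zero}          P _ p₁ _  _  = p₁
  by-symbol {suc (suc zero)}    P _ _  p₂ _  = p₂
  by-symbol {suc (suc (suc z))} P (_ , z≤s+2) _ _ p₃ = p₃ (s≤s (s≤s (s≤s z≤n))) z≤s+2

  row-count : ∀ r x → r ∈N n → x ∈N n → sumTo n (λ j → mult x (W r j)) ≡ k
  row-count r x r∈ x∈ with region {k} {s} r∈ | region {k} {s} x∈
  ... | inj₁ r∈K | inj₁ x∈K with x ≟ r
  ...   | yes refl = row-K-self r∈K
  ...   | no x≢r   = row-K-other r∈K x∈K x≢r
  row-count r x r∈ x∈ | inj₁ r∈K | inj₂ (z , z∈ , refl) =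
    by-symbol (λ z → sumTo n (λ j → mult (k + z) (W r j)) ≡ k) z∈ (row-K-k+1 r∈K) (row-K-k+2 r∈K) (row-K-beyond r∈K)
  row-count r x r∈ x∈ | inj₂ (w , w∈ , refl) | inj₁ x∈K = row-K'-K w∈ x∈K
  row-count r x r∈ x∈ | inj₂ (w , w∈ , refl) | inj₂ (z , z∈ , refl) =
    by-symbol (λ z → sumTo n (λ j → mult (k + z) (W (k + w) j)) ≡ k) z∈ (row-K'-k+1 w∈) (row-K'-k+2 w∈) (row-K'-beyond w∈)

  WellFormed : List ℕ → Set
  WellFormed l = length l ≡ k × All (_∈N n) l

  private
    suc[k∸1]≡k : suc (k ∸ 1) ≡ k
    suc[k∸1]≡k = trans (+-comm 1 (k ∸ 1)) k∸1+1≡k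

    length-tail : length (fromTo (k + 3) (k + s + 2)) ≡ s
    length-tail = trans (length-fromTo (k + 3) (k + s + 2))
      (trans (cong (_∸ (k + 3)) (lemma k s)) (m+n∸n≡m s (k + 3)))
      where
      lemma : ∀ k s → suc (k + s + 2) ≡ s + (k + 3)
      lemma = solve-∀

    All-K : All (_∈N n) (fromTo 1 k)
    All-K = All.map K⊆N (All-fromTo 1 k)

  wf-diag : ∀ {i} → i ∈N k → WellFormed (diagCell k i)
  wf-diag i∈ = trans (cong suc (length-replicate (k ∸ 1))) suc[k∸1]≡k , K⊆N i∈ ∷ replicate⁺ (k ∸ 1) (K'⊆N 1∈K')

  wf-off : ∀ {h d} → k < h → h ≤ k + 2 → d ∈N k → WellFormed (offCell k s h d)
  wf-off {h} {d} k<h h≤k+2 d∈ = length-off , (≤-trans (s≤s z≤n) k<h , ≤-trans h≤k+2 (+-monoˡ-≤ 2 (m≤m+n k s)))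
      ∷ ++⁺ (replicate⁺ c (K⊆N d∈)) (All.map tail∈N (All-fromTo (k + 3) (k + s + 2)))
    where
    tail∈N : ∀ {t} → k + 3 ≤ t × t ≤ k + s + 2 → t ∈N n
    tail∈N (k+3≤t , t≤n) = ≤-trans (s≤s z≤n) (≤-trans (m≤n+m 3 k) k+3≤t) , t≤n
    length-off : length (offCell k s h d) ≡ k
    length-off = begin
      suc (length (replicate c d ++ fromTo (k + 3) (k + s + 2))) ≡⟨ cong suc (length-++ (replicate c d)) ⟩
      suc (length (replicate c d) + length (fromTo (k + 3) (k + s + 2))) ≡⟨ cong suc (cong₂ _+_ (length-replicate c) length-tail) ⟩
      suc (c + s)                                                 ≡⟨ sym (+-suc c s) ⟩
      c + suc s                                                   ≡⟨ cong (c +_) (+-comm 1 s) ⟩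
      c + (s + 1)                                                 ≡⟨ c+s+1≡k ⟩
      k                                                           ∎
      where open ≡-Reasoning

  wf-side : ∀ {a y} → a ∈N k → y ∈N (s + 2) → WellFormed (sideCell k a (k + y))
  wf-side {a} {y} a∈ y∈ with y ≟ 1
  ... | yes refl rewrite sideCell-1 k a =
    trans (length-++ (replicate (k ∸ 1) a)) (trans (cong (_+ 1) (length-replicate (k ∸ 1))) k∸1+1≡k)
    , ++⁺ (replicate⁺ (k ∸ 1) (K⊆N a∈)) (K'⊆N 2∈K' ∷ [])
  ... | no y≢1 rewrite sideCell-2 k a (≢1⇒≥2 (proj₁ y∈) y≢1) =
    trans (cong suc (length-Kminus a∈)) suc[k∸1]≡k , K'⊆N y∈ ∷ All-Kminus k a All-K

  wf-corner : ∀ {w y} → w ∈N (s + 2) → y ∈N (s + 2) → WellFormed (W (k + w) (k + y))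
  wf-corner {w} {y} w∈ y∈ with star w y ≟ 1 | star w y ≟ 2 | w ≟ y
  ... | yes ≡1 | _      | _       = subst WellFormed (sym (corner-K w∈ y∈ ≡1)) (length-fromTo 1 k , All-K)
  ... | no ≢1  | yes ≡2 | _       = subst WellFormed (sym (corner-k+1 w∈ y∈ ≡2))
                                      (length-replicate k , replicate⁺ k (K'⊆N 1∈K'))
  ... | no ≢1  | no ≢2  | yes w≡y = subst WellFormed (sym (corner-k+2 w∈ y∈ ≢1 ≢2 w≡y))
                                      (length-replicate k , replicate⁺ k (K'⊆N 2∈K'))
  ... | no ≢1  | no ≢2  | no w≢y  = subst WellFormed (sym (corner-k+⋆ w∈ y∈ ≢1 ≢2 w≢y))
                                      (length-replicate k , replicate⁺ k (K'⊆N (S.closed w y w∈ y∈)))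

  cell-shape : ∀ i j → i ∈N n → j ∈N n → WellFormed (W i j)
  cell-shape i j i∈ j∈ with region {k} {s} i∈ | region {k} {s} j∈
  ... | inj₁ i∈K | inj₁ j∈K with j ≟ i
  ...   | yes refl = subst WellFormed (sym (cell-diag i∈K)) (wf-diag i∈K)
  ...   | no j≢i with cell-off i∈K j∈K j≢i
  ...     | h , k<h , h≤k+2 , eq = subst WellFormed (sym eq) (wf-off k<h h≤k+2 (Q.closed i j i∈K j∈K))
  cell-shape i j i∈ j∈ | inj₁ i∈K | inj₂ (y , y∈ , refl) = subst WellFormed (sym (V-KK' i∈K y∈)) (wf-side i∈K y∈)
  cell-shape i j i∈ j∈ | inj₂ (w , w∈ , refl) | inj₁ j∈K = subst WellFormed (sym (V-K'K w∈ j∈K)) (wf-side j∈K w∈)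
  cell-shape i j i∈ j∈ | inj₂ (w , w∈ , refl) | inj₂ (y , y∈ , refl) = wf-corner w∈ y∈

-- Columns of U are rows of its transpose, which is V again, for the
-- reversed quasigroups and the adjacency j = i ⊙ 1.

flip-quasigroup : ∀ {k op} → IsIdempotentQuasigroup k op → IsIdempotentQuasigroup k (flip op)
flip-quasigroup Q = record
  { closed      = λ a b a∈ b∈ → Q.closed b a b∈ a∈
  ; leftDiv     = Q.rightDiv
  ; leftCancel  = Q.rightCancel
  ; rightDiv    = Q.leftDiv
  ; rightCancel = Q.leftCancel
  ; idempotent  = Q.idempotent
  }
  where module Q = IsIdempotentQuasigroup Q

corner-flip : ∀ k star x y → cornerCell k star y x ≡ cornerCell k (flip star) x y
corner-flip k star x y rewrite ≡ᵇ-sym y x = refl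

module Transpose (k s : ℕ) (circ star : ℕ → ℕ → ℕ) where
  private
    module B  = Blocks k s circ star (adjU k)
    module Bᵀ = Blocks k s (flip circ) (flip star) (adjUᵀ k)

  U-transpose : ∀ {i j} → i ∈N (k + s + 2) → j ∈N (k + s + 2) →
                U k s circ star j i ≡ V k s (flip circ) (flip star) (adjUᵀ k) i j
  U-transpose {i} {j} i∈ j∈ with region {k} {s} i∈ | region {k} {s} j∈
  ... | inj₁ i∈K | inj₁ j∈K rewrite B.V-KK j∈K i∈K | Bᵀ.V-KK i∈K j∈K with i ≟ j
  ...   | yes refl rewrite ≡ᵇ-refl i = refl
  ...   | no i≢j rewrite ≢⇒≡ᵇ-false i≢j | ≢⇒≡ᵇ-false (≢-sym i≢j) = refl
  U-transpose i∈ j∈ | inj₁ i∈K | inj₂ (y , y∈ , refl) rewrite B.V-K'K y∈ i∈K | Bᵀ.V-KK' i∈K y∈ = refl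
  U-transpose i∈ j∈ | inj₂ (w , w∈ , refl) | inj₁ j∈K rewrite B.V-KK' j∈K w∈ | Bᵀ.V-K'K w∈ j∈K = refl
  U-transpose i∈ j∈ | inj₂ (w , w∈ , refl) | inj₂ (y , y∈ , refl)
    rewrite B.V-K'K' y∈ w∈ | Bᵀ.V-K'K' w∈ y∈ = corner-flip k star w y

U-latin : ∀ k s → 2 ≤ k → s < k → (circ star : ℕ → ℕ → ℕ) →
          IsIdempotentQuasigroup k circ → IsIdempotentQuasigroup (s + 2) star →
          IsKLatin k (k + s + 2) (U k s circ star)
U-latin k s 2≤k s<k circ star Q S = R.cell-shape , R.row-count , columns
  where
  module R  = RowCounts k s s<k circ star (adjU k) Q S (partners-U 2≤k)
  module Rᵀ = RowCounts k s s<k (flip circ) (flip star) (adjUᵀ k) (flip-quasigroup Q) (flip-quasigroup S) (partners-Uᵀ 2≤k)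
  columns : ∀ j x → j ∈N (k + s + 2) → x ∈N (k + s + 2) → sumTo (k + s + 2) (λ i → mult x (U k s circ star i j)) ≡ k
  columns j x j∈ x∈ = trans (sum-cong (k + s + 2) λ i i∈ → cong (mult x) (Transpose.U-transpose k s circ star j∈ i∈))
                               (Rᵀ.row-count j x j∈ x∈)

-- Let L₁ be a k₁-latin square contained cellwise in U and
-- P(i) the multiplicity of i in L₁(i,i).  Tracing the symbols k+1 and i
-- through the few cells of U containing them gives P(i ⊙ 1) = P(i), so P
-- is constant on K, and the symbol k+2 in column k+1 gives k₁ = k · P(1).
-- Hence k divides k₁, which is impossible for 0 < k₁ < k.
module NonSeparability (k s : ℕ) (2≤k : 2 ≤ k) (s<k : s < k) (circ star : ℕ → ℕ → ℕ)
                       (Q : IsIdempotentQuasigroup k circ) (S : IsIdempotentQuasigroup (s + 2) star) where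

  open Blocks k s circ star (adjU k)
  open RowCounts k s s<k circ star (adjU k) Q S (partners-U 2≤k)

  k+1-absent : ∀ {r j} → r ∈N n → j ∈N n → r ∈N k ⊎ j ∈N k → r ≢ j → (j ∈N k → r ≢ next k j) →
               mult (k + 1) (W r j) ≡ 0
  k+1-absent r∈ j∈ r∈K⊎j∈K r≢j not-next with region {k} {s} r∈ | region {k} {s} j∈
  ... | inj₁ r∈K | inj₁ j∈K = by-cell (trans (V-KK r∈K j∈K) (KK-far r≢j (≢⇒≡ᵇ-false (not-next j∈K))))
        (mult-off-absent k s k+1≢k+2 (≢-sym (K≢K' (Q.closed _ _ r∈K j∈K) ≤-refl)) (+-monoʳ-≤ k (s≤s z≤n)))
  ... | inj₁ r∈K | inj₂ (y , y∈ , refl) = by-cell (V-KK' r∈K y∈)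
        (mult-side-above (proj₂ r∈K) (proj₁ y∈) (k<k+y ≤-refl) (λ _ → k+1≢k+2) (λ 2≤y → K'≢K' (<⇒≢ 2≤y)))
  ... | inj₂ (w , w∈ , refl) | inj₁ j∈K = by-cell (V-K'K w∈ j∈K)
        (mult-side-above (proj₂ j∈K) (proj₁ w∈) (k<k+y ≤-refl) (λ _ → k+1≢k+2) (λ 2≤w → K'≢K' (<⇒≢ 2≤w)))
  ... | inj₂ (w , w∈ , refl) | inj₂ (y , y∈ , refl) with r∈K⊎j∈K
  ...   | inj₁ (_ , k+w≤k) = ⊥-elim (<⇒≱ (k<k+y (proj₁ w∈)) k+w≤k)
  ...   | inj₂ (_ , k+y≤k) = ⊥-elim (<⇒≱ (k<k+y (proj₁ y∈)) k+y≤k)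

  self-absent : ∀ {i j} → i ∈N k → j ∈N n → j ≢ i → j ≢ k + 1 → mult i (W i j) ≡ 0
  self-absent {i} i∈ j∈ j≢i j≢k+1 with region {k} {s} j∈
  ... | inj₁ j∈K with cell-off i∈ j∈K j≢i
  ...   | h , k<h , _ , eq = by-cell eq
            (mult-off-absent k s (<⇒≢ (≤-<-trans (proj₂ i∈) k<h)) (≢-sym (circ≢ i∈ j∈K j≢i)) (≤k+2 i∈))
  self-absent i∈ j∈ j≢i j≢k+1 | inj₂ (y , y∈ , refl) with y ≟ 1
  ... | yes refl = ⊥-elim (j≢k+1 refl)
  ... | no y≢1   = by-cell (cell-side₂ i∈ y∈ (≢1⇒≥2 (proj₁ y∈) y≢1)) (mult-side-self i∈ (proj₁ y∈))

  corner-column-k+1 : ∀ {w} → w ∈N (s + 2) → mult (k + 2) (W (k + w) (k + 1)) ≡ 0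
  corner-column-k+1 w∈ = corner-no-k+2 w∈ 1∈K'
    λ ≢1 _ w≡1 → ≢1 (trans (cong (λ t → star t 1) w≡1) (S.idempotent 1 1∈K'))

  module Contained {k₁ : ℕ} {L₁ : Array} (latin₁ : IsKLatin k₁ n L₁)
                   (L₁⊆U : ∀ x i j → i ∈N n → j ∈N n → mult x (L₁ i j) ≤ mult x (W i j)) where

    private
      length₁ : ∀ i j → i ∈N n → j ∈N n → length (L₁ i j) ≡ k₁
      length₁ i j i∈ j∈ = proj₁ (proj₁ latin₁ i j i∈ j∈)
      rows₁ : ∀ i x → i ∈N n → x ∈N n → sumTo n (λ j → mult x (L₁ i j)) ≡ k₁
      rows₁ = proj₁ (proj₂ latin₁)
      cols₁ : ∀ j x → j ∈N n → x ∈N n → sumTo n (λ i → mult x (L₁ i j)) ≡ k₁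
      cols₁ = proj₂ (proj₂ latin₁)

    absent₁ : ∀ {x i j} → i ∈N n → j ∈N n → mult x (W i j) ≡ 0 → mult x (L₁ i j) ≡ 0
    absent₁ {x} {i} {j} i∈ j∈ eq = n≤0⇒n≡0 (≤-trans (L₁⊆U x i j i∈ j∈) (≤-reflexive eq))

    P : ℕ → ℕ
    P i = mult i (L₁ i i)

    diagonal : ∀ {i} → i ∈N k → P i + mult (k + 1) (L₁ i i) ≡ k₁
    diagonal {i} i∈ = trans (sym (length-two-symbols (L₁ i i) (K≢K' i∈ ≤-refl)
                        λ y y≢i y≢k+1 → absent₁ (K⊆N i∈) (K⊆N i∈) (by-cell (cell-diag i∈) (mult-diag-absent y≢i y≢k+1))))
                      (length₁ i i (K⊆N i∈) (K⊆N i∈))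

    row-next : ∀ {i} → i ∈N k → mult (k + 1) (L₁ (next k i) (next k i)) + mult (k + 1) (L₁ (next k i) i) ≡ k₁
    row-next {i} i∈ = trans (sym (sum-two n (next k i) i (K⊆N q∈) (K⊆N i∈) (next≢ 2≤k i∈) λ j j∈ j≢q j≢i →
        absent₁ (K⊆N q∈) j∈ (k+1-absent (K⊆N q∈) j∈ (inj₁ q∈) (≢-sym j≢q)
          λ j∈K q≡next-j → j≢i (next-injective j∈K i∈ (sym q≡next-j)))))
      (rows₁ (next k i) (k + 1) (K⊆N q∈) (K'⊆N 1∈K'))
      where
      q∈ : next k i ∈N k
      q∈ = next∈K i∈

    column : ∀ {i} → i ∈N k → mult (k + 1) (L₁ i i) + mult (k + 1) (L₁ (next k i) i) ≡ k₁
    column {i} i∈ = trans (sym (sum-two n {λ r → mult (k + 1) (L₁ r i)} i (next k i) (K⊆N i∈) (K⊆N (next∈K i∈))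
        (≢-sym (next≢ 2≤k i∈)) λ r r∈ r≢i r≢q →
          absent₁ r∈ (K⊆N i∈) (k+1-absent r∈ (K⊆N i∈) (inj₂ i∈) r≢i λ _ → r≢q)))
      (cols₁ i (k + 1) (K⊆N i∈) (K'⊆N 1∈K'))

    -- P(i⊙1) and P(i) both equal the multiplicity of k+1 in L₁(i⊙1, i).
    P-next : ∀ {i} → i ∈N k → P (next k i) ≡ P i
    P-next {i} i∈ = trans (sym via-row) via-column
      where
      q : ℕ
      q = next k i
      via-row : mult (k + 1) (L₁ q i) ≡ P q
      via-row = +-cancelˡ-≡ (mult (k + 1) (L₁ q q)) _ _
        (trans (row-next i∈) (trans (sym (diagonal (next∈K i∈))) (+-comm (P q) _)))
      via-column : mult (k + 1) (L₁ q i) ≡ P i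
      via-column = +-cancelˡ-≡ (mult (k + 1) (L₁ i i)) _ _
        (trans (column i∈) (trans (sym (diagonal i∈)) (+-comm (P i) _)))

    P-constant : ∀ {i} → i ∈N k → P i ≡ P 1
    P-constant {suc m} (_ , m<k) = go m m<k
      where
      go : ∀ m → suc m ≤ k → P (suc m) ≡ P 1
      go zero    _     = refl
      go (suc m) m+2≤k with next-cases {k} {suc m} (s≤s z≤n , <⇒≤ m+2≤k)
      ... | inj₁ (_ , next≡) = trans (cong P (sym next≡)) (trans (P-next (s≤s z≤n , <⇒≤ m+2≤k)) (go m (<⇒≤ m+2≤k)))
      ... | inj₂ (m+1≡k , _) = ⊥-elim (<⇒≢ m+2≤k m+1≡k)

    -- L₁(i, k+1) consists of i and k+2; with row i this gives mult (k+2) (L₁ i (k+1)) = P i.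
    side : ∀ {i} → i ∈N k → mult (k + 2) (L₁ i (k + 1)) ≡ P i
    side {i} i∈ = +-cancelˡ-≡ (mult i (L₁ i (k + 1))) _ _ (trans cell (trans (sym row) (+-comm (P i) _)))
      where
      cell : mult i (L₁ i (k + 1)) + mult (k + 2) (L₁ i (k + 1)) ≡ k₁
      cell = trans (sym (length-two-symbols (L₁ i (k + 1)) (K≢K' i∈ (s≤s z≤n)) λ y y≢i y≢k+2 →
               absent₁ (K⊆N i∈) (K'⊆N 1∈K') (by-cell (cell-side₁ i∈) (mult-side₁-absent y≢i y≢k+2))))
             (length₁ i (k + 1) (K⊆N i∈) (K'⊆N 1∈K'))
      row : P i + mult i (L₁ i (k + 1)) ≡ k₁
      row = trans (sym (sum-two n {λ j → mult i (L₁ i j)} i (k + 1) (K⊆N i∈) (K'⊆N 1∈K') (K≢K' i∈ ≤-refl)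
              λ j j∈ j≢i j≢k+1 → absent₁ (K⊆N i∈) j∈ (self-absent i∈ j∈ j≢i j≢k+1)))
            (rows₁ i i (K⊆N i∈) (K⊆N i∈))

    -- Column k+1 holds k₁ copies of k+2, all in its K rows, P(1) in each.
    k∣k₁ : k ∣ k₁
    k∣k₁ = divides (P 1) (begin
      k₁                                           ≡⟨ sym (cols₁ (k + 1) (k + 2) (K'⊆N 1∈K') (K'⊆N 2∈K')) ⟩
      sumTo n f                                    ≡⟨ row-split f ⟩
      sumTo k f + sumTo (s + 2) (λ w → f (k + w))  ≡⟨ cong₂ _+_ K-rows K'-rows ⟩
      sumTo k (λ _ → P 1) + 0                      ≡⟨ +-identityʳ _ ⟩
      sumTo k (λ _ → P 1)                          ≡⟨ sum-const k (P 1) ⟩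
      k * P 1                                      ≡⟨ *-comm k (P 1) ⟩
      P 1 * k                                      ∎)
      where
      open ≡-Reasoning
      f : ℕ → ℕ
      f r = mult (k + 2) (L₁ r (k + 1))
      K-rows : sumTo k f ≡ sumTo k (λ _ → P 1)
      K-rows = sum-cong k λ r r∈ → trans (side r∈) (P-constant r∈)
      K'-rows : sumTo (s + 2) (λ w → f (k + w)) ≡ 0
      K'-rows = sum-zero (s + 2) λ w w∈ → absent₁ (K'⊆N w∈) (K'⊆N 1∈K') (corner-column-k+1 w∈)

  U-non-separable : NonSeparable k n (U k s circ star)
  U-non-separable (k₁ , k₂ , L₁ , L₂ , 1≤k₁ , 1≤k₂ , k₁+k₂≡k , latin₁ , _ , join) =
    <⇒≱ k₁<k (∣⇒≤ ⦃ >-nonZero 1≤k₁ ⦄ (Contained.k∣k₁ latin₁ L₁⊆U))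
    where
    L₁⊆U : ∀ x i j → i ∈N n → j ∈N n → mult x (L₁ i j) ≤ mult x (W i j)
    L₁⊆U x i j i∈ j∈ = ≤-trans (m≤m+n _ (mult x (L₂ i j)))
      (≤-reflexive (sym (trans (mult-↭ x (join i j i∈ j∈)) (mult-++ x (L₁ i j) (L₂ i j)))))
    k₁<k : k₁ < k
    k₁<k = ≤-trans (≤-trans (≤-reflexive (+-comm 1 k₁)) (+-monoʳ-≤ k₁ 1≤k₂)) (≤-reflexive k₁+k₂≡k)

mainTheorem10 : (k s : ℕ) → 3 ≤ k → 1 ≤ s → s < k →
    (circ star : ℕ → ℕ → ℕ) →
    IsIdempotentQuasigroup k circ → IsIdempotentQuasigroup (s + 2) star →
    IsKLatin k (k + s + 2) (U k s circ star) × NonSeparable k (k + s + 2) (U k s circ star)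
mainTheorem10 k s 3≤k _ s<k circ star Q S =
    U-latin k s 2≤k s<k circ star Q S
  , NonSeparability.U-non-separable k s 2≤k s<k circ star Q S
  where
  2≤k : 2 ≤ k
  2≤k = ≤-trans (n≤1+n 2) 3≤k
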